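{- A tree $T$ is an EOCD graph if and only if $T$ can be obtained from $K_2$ by a sequence of operations $O_1$–$O_5$.
   Context: Graphs are finite and simple. A set $P\subseteq V(G)$ is an ECD set if the closed neighborhoods $N[v]$, $v\in P$, partition $V(G)$; a set $D\subseteq V(G)$ is an EOD set if the open neighborhoods $N(v)$, $v\in D$, partition $V(G)$; $G$ is an EOCD graph if it has both. The operations are applied to an EOCD tree $T'$ together with a chosen EOD set $D'$ and ECD set $P'$ of $T'$ (degrees are taken in $T'$): $(O_1)$ For $u\in D'\cap P'$, obtain $T$ from $T'$ by adding a vertex $v$ and the edge $uv$. $(O_2)$ For $w\notin D'$, obtain $T$ from $T'$ by adding a new path $xuv$ and the edge $wx$. $(O_3)$ For $t\in D'-P'$, obtain $T$ from $T'$ by adding a new path $zwxuv$ and the edge $tz$. $(O_4)$ For a path $vux$ in $T'$ with $\deg(v)=1$, $\deg(u)=2$, $u,x\in D'$ and $u\in P'$, obtain $T$ from $T'$ by adding a vertex $y$ and the edge $yx$. $(O_5)$ For a path $uxwzw'x'$ in $T'$ with $\deg(u)=\deg(x')=1$, $\deg(x)=\deg(w)=\deg(w')=2$, $u,x,w',x'\in D'$ and $x,w'\in P'$, obtain $T$ from $T'$ by adding a vertex $v$ and the edge $uv$. A sequence starting from $K_2$ means each operation is applied to the tree produced so far, with respect to some EOD set and ECD set of that tree. -}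

module Defs where

open import Data.Nat using (ℕ; zero; suc; _≤_; _+_)
open import Data.Fin using (Fin; zero; suc; _≟_)
open import Data.Bool using (Bool; true; false; if_then_else_)
open import Data.List using (List; []; _∷_; _++_; [_]; length; map; allFin)
open import Data.Nat.ListAction using (sum)
open import Data.Sum using (_⊎_)
open import Data.List.Relation.Unary.Linked using (Linked)
open import Data.List.Relation.Unary.Unique.Propositional using (Unique)
open import Data.Product using (Σ; ∃; ∃-syntax; ∃!; _×_; _,_)
open import Data.Empty using (⊥)
open import Relation.Nullary using (¬_; yes; no)
open import Relation.Nullary.Decidable using (⌊_⌋)
open import Relation.Binary.PropositionalEquality using (_≡_; _≢_; refl)
open import Function.Bundles using (_↔_; Inverse)

record Graph (n : ℕ) : Set where
  field
    adj    : Fin n → Fin n → Bool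
    sym    : ∀ i j → adj i j ≡ adj j i
    irrefl : ∀ i → adj i i ≡ false
open Graph public

Adj : ∀ {n} → Graph n → Fin n → Fin n → Set
Adj G i j = adj G i j ≡ true

deg : ∀ {n} → Graph n → Fin n → ℕ
deg {n} G i = sum (map (λ j → if adj G i j then 1 else 0) (allFin n))

data Reach {n} (G : Graph n) : Fin n → Fin n → Set where
  here : ∀ {u} → Reach G u u
  step : ∀ {u w v} → Adj G u w → Reach G w v → Reach G u v

Connected : ∀ {n} → Graph n → Set
Connected G = ∀ u v → Reach G u v

IsCycle : ∀ {n} → Graph n → Fin n → List (Fin n) → Set
IsCycle G v xs = 2 ≤ length xs × Unique (v ∷ xs) × Linked (Adj G) (v ∷ xs ++ [ v ])

Acyclic : ∀ {n} → Graph n → Set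
Acyclic G = ∀ v xs → ¬ IsCycle G v xs

IsTree : ∀ {n} → Graph n → Set
IsTree {n} G = 1 ≤ n × Connected G × Acyclic G

Subset : ℕ → Set
Subset n = Fin n → Bool

-- closed neighbourhoods N[v], v ∈ P, partition V(G):
-- every vertex lies in exactly one of them
IsECD : ∀ {n} → Graph n → Subset n → Set
IsECD G P = ∀ w → ∃! _≡_ (λ v → P v ≡ true × (v ≡ w ⊎ Adj G v w))

-- open neighbourhoods N(v), v ∈ D, partition V(G)
IsEOD : ∀ {n} → Graph n → Subset n → Set
IsEOD G D = ∀ w → ∃! _≡_ (λ v → D v ≡ true × Adj G v w)

IsEOCD : ∀ {n} → Graph n → Set
IsEOCD G = (∃ λ D → IsEOD G D) × (∃ λ P → IsECD G P)

K2 : Graph 2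
K2 = record { adj = a ; sym = s ; irrefl = r }
  where
  a : Fin 2 → Fin 2 → Bool
  a zero zero = false
  a zero (suc zero) = true
  a (suc zero) zero = true
  a (suc zero) (suc zero) = false
  s : ∀ i j → a i j ≡ a j i
  s zero zero = refl
  s zero (suc zero) = refl
  s (suc zero) zero = refl
  s (suc zero) (suc zero) = refl
  r : ∀ i → a i i ≡ false
  r zero = refl
  r (suc zero) = refl

-- add a new vertex (index zero; old vertex i becomes suc i)
-- together with the single edge joining it to u
addLeaf : ∀ {n} → Graph n → Fin n → Graph (suc n)
addLeaf {n} G u = record { adj = a ; sym = s ; irrefl = r }
  where
  a : Fin (suc n) → Fin (suc n) → Bool
  a zero zero = false
  a zero (suc j) = ⌊ j ≟ u ⌋
  a (suc i) zero = ⌊ i ≟ u ⌋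
  a (suc i) (suc j) = adj G i j
  s : ∀ i j → a i j ≡ a j i
  s zero zero = refl
  s zero (suc j) = refl
  s (suc i) zero = refl
  s (suc i) (suc j) = sym G i j
  r : ∀ i → a i i ≡ false
  r zero = refl
  r (suc i) = irrefl G i

-- add a new path x₁ x₂ … x_k (k = suc m) and the edge u x₁;
-- the new vertices are the first suc m indices, x_k being index zero
addPendantPath : ∀ {n} m → Graph n → Fin n → Graph (suc m + n)
addPendantPath zero    G u = addLeaf G u
addPendantPath (suc m) G u = addLeaf (addPendantPath m G u) zero

_≅_ : ∀ {n m} → Graph n → Graph m → Set
_≅_ {n} {m} G H = Σ (Fin n ↔ Fin m) λ f →
  ∀ i j → adj H (Inverse.to f i) (Inverse.to f j) ≡ adj G i j

-- Trees obtainable from K₂ by a sequence of operations O₁–O₅.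
-- Each operation is applied to the current tree T' with respect to
-- some EOD set D and ECD set P of T'; degrees are taken in T'.

data Gen : ∀ {n} → Graph n → Set where
  base : Gen K2
  O1 : ∀ {n} {T : Graph n} → Gen T →
       (D P : Subset n) → IsEOD T D → IsECD T P →
       (u : Fin n) → D u ≡ true → P u ≡ true →
       Gen (addLeaf T u)
  O2 : ∀ {n} {T : Graph n} → Gen T →
       (D P : Subset n) → IsEOD T D → IsECD T P →
       (w : Fin n) → D w ≡ false →
       Gen (addPendantPath 2 T w)
  O3 : ∀ {n} {T : Graph n} → Gen T →
       (D P : Subset n) → IsEOD T D → IsECD T P →
       (t : Fin n) → D t ≡ true → P t ≡ false →
       Gen (addPendantPath 4 T t)
  O4 : ∀ {n} {T : Graph n} → Gen T →
       (D P : Subset n) → IsEOD T D → IsECD T P →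
       (v u x : Fin n) → v ≢ u → v ≢ x → u ≢ x →
       Adj T v u → Adj T u x →
       deg T v ≡ 1 → deg T u ≡ 2 →
       D u ≡ true → D x ≡ true → P u ≡ true →
       Gen (addLeaf T x)
  O5 : ∀ {n} {T : Graph n} → Gen T →
       (D P : Subset n) → IsEOD T D → IsECD T P →
       (u x w z w' x' : Fin n) →
       Unique (u ∷ x ∷ w ∷ z ∷ w' ∷ x' ∷ []) →
       Linked (Adj T) (u ∷ x ∷ w ∷ z ∷ w' ∷ x' ∷ []) →
       deg T u ≡ 1 → deg T x' ≡ 1 →
       deg T x ≡ 2 → deg T w ≡ 2 → deg T w' ≡ 2 →
       D u ≡ true → D x ≡ true → D w' ≡ true → D x' ≡ true →
       P x ≡ true → P w' ≡ true →
       Gen (addLeaf T u)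

Obtainable : ∀ {n} → Graph n → Set
Obtainable T = ∃[ m ] Σ (Graph m) λ G → Gen G × (G ≅ T)

module Submission where

open import Defs hiding (sym)

open import Axiom.UniquenessOfIdentityProofs using (module Decidable⇒UIP)
open import Data.Bool using (Bool; true; false; if_then_else_)
import Data.Bool as Bool
open import Data.Empty using (⊥; ⊥-elim)
open import Data.Fin using (Fin; zero; suc; punchIn; punchOut)
import Data.Fin as Fin
open import Data.Fin.Properties
  using (_≟_; any?; pigeonhole; punchIn-punchOut; punchOut-punchIn; punchInᵢ≢i; punchIn-injective; punchOut-cong)
  renaming (suc-injective to fsuc-injective)
open import Data.List using (List; []; _∷_; _++_; [_]; map; length; lookup; tabulate)
open import Data.Maybe using (Maybe; just; nothing)
open import Data.List.Properties using (map-++; length-map; ++-assoc)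
open import Data.List.Relation.Unary.All using (All; []; _∷_)
import Data.List.Relation.Unary.All as All
import Data.List.Relation.Unary.All.Properties as AllP
open import Data.List.Relation.Unary.AllPairs using (AllPairs; []; _∷_)
open import Data.List.Relation.Unary.Linked using (Linked; []; [-]; _∷_)
import Data.List.Relation.Unary.Linked as Linked
import Data.List.Relation.Unary.Linked.Properties as LinkedP
open import Data.List.Relation.Unary.Unique.Propositional using (Unique)
import Data.List.Relation.Unary.Unique.Propositional.Properties as UniqueP
open import Data.Nat using (ℕ; zero; suc; _+_; _<_; _≤_; z≤n; s≤s)
open import Data.Nat.Induction using (<-rec)
open import Data.Nat.ListAction using (sum)
open import Data.Nat.Properties using (suc-injective; +-suc; +-identityʳ; m<m+n)
open import Data.Product using (Σ; ∃; ∃!; _×_; _,_; proj₁; proj₂)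
open import Data.Sum using (_⊎_; inj₁; inj₂; [_,_]′)
import Data.Sum as Sum
open import Function using (_∘_; id)
open import Function.Bundles using (_↔_; _⇔_; Inverse; mk↔ₛ′; mk⇔)
open import Relation.Binary.PropositionalEquality
  using (_≡_; _≢_; refl; sym; trans; cong; cong₂; subst; subst₂; ≢-sym)
open import Relation.Nullary using (¬_; yes; no; Dec)
open import Relation.Nullary.Decidable using (⌊_⌋; _×-dec_; ¬?)

-- Soundness: every operation adds pendant vertices one at a time, and
-- adding a leaf extends EOD / ECD sets that are exact, or exact except at
-- one vertex, to such sets ('AddLeaf'); for O₄, O₅ the ECD set is first
-- shifted along the fixed path ('ecdAfterO4', 'ecdAfterO5').
-- Completeness, by strong induction on the number of vertices: rooting T
-- at a leaf and exploring it bottom-up, every branch either has one of four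
-- small labelled shapes L, S, Q, R ('Branch') or contains a configuration
-- in which a pendant path can be peeled off, leaving a smaller EOCD tree
-- from which T arises by one operation ('reduceO1' … 'reduceO5').

≟-true : ∀ {n} {i j : Fin n} → ⌊ i ≟ j ⌋ ≡ true → i ≡ j
≟-true {i = i} {j} e with i ≟ j
... | yes p = p
≟-true e | no _ with () ← e

≟-refl : ∀ {n} (i : Fin n) → ⌊ i ≟ i ⌋ ≡ true
≟-refl i with i ≟ i
... | yes _ = refl
... | no q = ⊥-elim (q refl)

≟-false : ∀ {n} {i j : Fin n} → i ≢ j → ⌊ i ≟ j ⌋ ≡ false
≟-false {i = i} {j} q with i ≟ j
... | yes p = ⊥-elim (q p)
... | no _ = refl

t≢f : true ≢ false
t≢f ()

clash : ∀ {b} → b ≡ true → b ≡ false → ⊥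
clash p q = t≢f (trans (sym p) q)

¬true⇒false : ∀ {b} → ¬ (b ≡ true) → b ≡ false
¬true⇒false {true} h = ⊥-elim (h refl)
¬true⇒false {false} h = refl

labelsDiffer : ∀ {n} {a b : Fin n} (S : Fin n → Bool) → S a ≡ true → S b ≡ false → a ≢ b
labelsDiffer S sa sb e = clash sa (trans (cong S e) sb)

boolIrr : ∀ {a b : Bool} (p q : a ≡ b) → p ≡ q
boolIrr = Decidable⇒UIP.≡-irrelevant Bool._≟_

adjSym : ∀ {n} (G : Graph n) {i j} → Adj G i j → Adj G j i
adjSym G {i} {j} a = trans (sym (Graph.sym G i j)) a

adjIrr : ∀ {n} (G : Graph n) {i j} → Adj G i j → i ≢ j
adjIrr G {i} a refl with () ← trans (sym a) (Graph.irrefl G i)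

OnlyNeighbour : ∀ {n} → Graph n → Fin n → Fin n → Set
OnlyNeighbour G v u = Adj G v u × (∀ y → Adj G v y → y ≡ u)

TwoNeighbours : ∀ {n} → Graph n → Fin n → Fin n → Fin n → Set
TwoNeighbours G v a b = a ≢ b × Adj G v a × Adj G v b × (∀ y → Adj G v y → y ≡ a ⊎ y ≡ b)

twoSwap : ∀ {n} (G : Graph n) {a b c} → TwoNeighbours G a b c → TwoNeighbours G a c b
twoSwap G (b≢c , ab , ac , q) = (λ e → b≢c (sym e)) , ac , ab , λ y ay → [ inj₂ , inj₁ ]′ (q y ay)

-- Degrees: the degree counts the true entries of a row of the adjacency
-- matrix, so degree 1 (resp. 2) means exactly one (resp. two) neighbours.

indicator : Bool → ℕ
indicator b = if b then 1 else 0

count : ∀ {n} → (Fin n → Bool) → ℕ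
count {zero} f = 0
count {suc n} f = indicator (f zero) + count (f ∘ suc)

sum-indicator : ∀ {A : Set} n (h : Fin n → A) (g : A → Bool) →
         sum (map (λ a → indicator (g a)) (tabulate h)) ≡ count (g ∘ h)
sum-indicator zero h g = refl
sum-indicator (suc n) h g = cong (indicator (g (h zero)) +_) (sum-indicator n (h ∘ suc) g)

deg≡count : ∀ {n} (G : Graph n) v → deg G v ≡ count (adj G v)
deg≡count {n} G v = sum-indicator n id (adj G v)

count0⇒ : ∀ {n} (f : Fin n → Bool) → count f ≡ 0 → ∀ j → f j ≡ false
count0⇒ {suc n} f e j with f zero in fz
count0⇒ {suc n} f e zero | false = fz
count0⇒ {suc n} f e (suc j) | false = count0⇒ (f ∘ suc) e j
count0⇒ {suc n} f () j | true

count0⇐ : ∀ {n} (f : Fin n → Bool) → (∀ j → f j ≡ false) → count f ≡ 0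
count0⇐ {zero} f h = refl
count0⇐ {suc n} f h rewrite h zero = count0⇐ (f ∘ suc) (λ j → h (suc j))

count1⇒ : ∀ {n} (f : Fin n → Bool) → count f ≡ 1 → Σ (Fin n) λ u → f u ≡ true × (∀ j → f j ≡ true → j ≡ u)
count1⇒ {suc n} f e with f zero in fz
... | true = zero , fz , λ { zero _ → refl ; (suc j) fj → ⊥-elim (t≢f (trans (sym fj) (count0⇒ (f ∘ suc) (suc-injective e) j))) }
... | false with count1⇒ (f ∘ suc) e
... | u , fu , uq = suc u , fu , λ { zero fj → ⊥-elim (t≢f (trans (sym fj) fz)) ; (suc j) fj → cong suc (uq j fj) }

count1⇐ : ∀ {n} (f : Fin n → Bool) u → f u ≡ true → (∀ j → f j ≡ true → j ≡ u) → count f ≡ 1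
count1⇐ {suc n} f zero fu uq rewrite fu = cong suc (count0⇐ (f ∘ suc) λ j → aux j)
  where
  aux : ∀ j → f (suc j) ≡ false
  aux j with f (suc j) in e
  ... | false = refl
  ... | true with () ← uq (suc j) e
count1⇐ {suc n} f (suc u) fu uq with f zero in fz
... | true with () ← uq zero fz
... | false = count1⇐ (f ∘ suc) u fu λ j fj → fsuc-injective (uq (suc j) fj)

count2⇒ : ∀ {n} (f : Fin n → Bool) → count f ≡ 2 →
        Σ (Fin n) λ a → Σ (Fin n) λ b → a ≢ b × f a ≡ true × f b ≡ true × (∀ j → f j ≡ true → j ≡ a ⊎ j ≡ b)
count2⇒ {suc n} f e with f zero in fz
... | true with count1⇒ (f ∘ suc) (suc-injective e)
... | u , fu , uq = zero , suc u , (λ ()) , fz , fu , λ { zero _ → inj₁ refl ; (suc j) fj → inj₂ (cong suc (uq j fj)) }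
count2⇒ {suc n} f e | false with count2⇒ (f ∘ suc) e
... | a , b , a≢b , fa , fb , q = suc a , suc b , (λ p → a≢b (fsuc-injective p)) , fa , fb ,
      λ { zero fj → ⊥-elim (t≢f (trans (sym fj) fz))
        ; (suc j) fj → Sum.map (cong suc) (cong suc) (q j fj) }

count2⇐ : ∀ {n} (f : Fin n → Bool) a b → a ≢ b → f a ≡ true → f b ≡ true → (∀ j → f j ≡ true → j ≡ a ⊎ j ≡ b) → count f ≡ 2
count2⇐ {suc n} f zero zero a≢b fa fb q = ⊥-elim (a≢b refl)
count2⇐ {suc n} f zero (suc b) a≢b fa fb q rewrite fa =
  cong suc (count1⇐ (f ∘ suc) b fb λ j fj → aux j (q (suc j) fj))
  where
  aux : ∀ j → suc j ≡ zero ⊎ suc j ≡ suc b → j ≡ b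
  aux j (inj₁ ())
  aux j (inj₂ p) = fsuc-injective p
count2⇐ {suc n} f (suc a) zero a≢b fa fb q rewrite fb =
  cong suc (count1⇐ (f ∘ suc) a fa λ j fj → aux j (q (suc j) fj))
  where
  aux : ∀ j → suc j ≡ suc a ⊎ suc j ≡ zero → j ≡ a
  aux j (inj₂ ())
  aux j (inj₁ p) = fsuc-injective p
count2⇐ {suc n} f (suc a) (suc b) a≢b fa fb q with f zero in fz
... | true with q zero fz
... | inj₁ ()
... | inj₂ ()
count2⇐ {suc n} f (suc a) (suc b) a≢b fa fb q | false =
  count2⇐ (f ∘ suc) a b (λ p → a≢b (cong suc p)) fa fb
    λ j fj → Sum.map fsuc-injective fsuc-injective (q (suc j) fj)

deg1⇒ : ∀ {n} (G : Graph n) v → deg G v ≡ 1 → Σ (Fin n) λ u → OnlyNeighbour G v u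
deg1⇒ G v e = count1⇒ (adj G v) (trans (sym (deg≡count G v)) e)

deg1⇐ : ∀ {n} (G : Graph n) v u → OnlyNeighbour G v u → deg G v ≡ 1
deg1⇐ G v u (a , q) = trans (deg≡count G v) (count1⇐ (adj G v) u a q)

deg2⇒ : ∀ {n} (G : Graph n) v → deg G v ≡ 2 → Σ (Fin n) λ a → Σ (Fin n) λ b → TwoNeighbours G v a b
deg2⇒ G v e = count2⇒ (adj G v) (trans (sym (deg≡count G v)) e)

deg2⇐ : ∀ {n} (G : Graph n) v a b → TwoNeighbours G v a b → deg G v ≡ 2
deg2⇐ G v a b (d , x , y , q) = trans (deg≡count G v) (count2⇐ (adj G v) a b d x y q)

twoFix : ∀ {n} (G : Graph n) u a b v x → TwoNeighbours G u a b → Adj G u v → Adj G u x → v ≢ x → TwoNeighbours G u v x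
twoFix G u a b v x (a≢b , aa , ab , q) av ax v≢x = v≢x , av , ax , q'
  where
  q' : ∀ y → Adj G u y → y ≡ v ⊎ y ≡ x
  q' y ay with q y ay | q v av | q x ax
  ... | inj₁ refl | inj₁ refl | _ = inj₁ refl
  ... | inj₁ refl | inj₂ refl | inj₁ refl = inj₂ refl
  ... | inj₁ refl | inj₂ refl | inj₂ refl = ⊥-elim (v≢x refl)
  ... | inj₂ refl | inj₂ refl | _ = inj₁ refl
  ... | inj₂ refl | inj₁ refl | inj₂ refl = inj₂ refl
  ... | inj₂ refl | inj₁ refl | inj₁ refl = ⊥-elim (v≢x refl)

oneFix : ∀ {n} (G : Graph n) v a u → OnlyNeighbour G v a → Adj G v u → OnlyNeighbour G v u
oneFix G v a u (_ , q) avu = avu , λ y ay → trans (q y ay) (sym (q u avu))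

deg1Nb : ∀ {n} (G : Graph n) v u → deg G v ≡ 1 → Adj G v u → OnlyNeighbour G v u
deg1Nb G v u d a with deg1⇒ G v d
... | a' , o = oneFix G v a' u o a

deg2Nb : ∀ {n} (G : Graph n) u v x → deg G u ≡ 2 → Adj G u v → Adj G u x → v ≢ x → TwoNeighbours G u v x
deg2Nb G u v x d av ax q with deg2⇒ G u d
... | a , b , t = twoFix G u a b v x t av ax q

module _ {n m : ℕ} (f : Fin n ↔ Fin m) where
  open Inverse f
  toFrom : ∀ y → to (from y) ≡ y
  toFrom = strictlyInverseˡ
  fromTo : ∀ x → from (to x) ≡ x
  fromTo = strictlyInverseʳ
  toInj : ∀ {x y} → to x ≡ to y → x ≡ y
  toInj {x} {y} e = trans (sym (fromTo x)) (trans (cong from e) (fromTo y))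
  fromInj : ∀ {x y} → from x ≡ from y → x ≡ y
  fromInj {x} {y} e = trans (sym (toFrom x)) (trans (cong to e) (toFrom y))

isoTo : ∀ {n m} {ℓ} {P : Fin n ↔ Fin m → Set ℓ} → Σ (Fin n ↔ Fin m) P → Fin n → Fin m
isoTo σ = Inverse.to (proj₁ σ)

isoFrom : ∀ {n m} {ℓ} {P : Fin n ↔ Fin m → Set ℓ} → Σ (Fin n ↔ Fin m) P → Fin m → Fin n
isoFrom σ = Inverse.from (proj₁ σ)

isoSym : ∀ {n m} {G : Graph n} {H : Graph m} → G ≅ H → H ≅ G
isoSym {G = G} {H} (f , e) =
  mk↔ₛ′ (Inverse.from f) (Inverse.to f) (fromTo f) (toFrom f) ,
  λ a b → trans (sym (e (Inverse.from f a) (Inverse.from f b))) (cong₂ (adj H) (toFrom f a) (toFrom f b))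

isoTrans : ∀ {n m k} {G : Graph n} {H : Graph m} {K : Graph k} → G ≅ H → H ≅ K → G ≅ K
isoTrans {G = G} {H} {K} (f , e) (g , e') =
  mk↔ₛ′ (Inverse.to g ∘ Inverse.to f) (Inverse.from f ∘ Inverse.from g)
    (λ y → trans (cong (Inverse.to g) (toFrom f (Inverse.from g y))) (toFrom g y))
    (λ x → trans (cong (Inverse.from f) (fromTo g (Inverse.to f x))) (fromTo f x)) ,
  λ i j → trans (e' (Inverse.to f i) (Inverse.to f j)) (e i j)

isoAdj : ∀ {n m} (G : Graph n) (H : Graph m) (σ : G ≅ H) {i j} → Adj G i j → Adj H (isoTo σ i) (isoTo σ j)
isoAdj G H (f , e) {i} {j} a = trans (e i j) a

isoAdj⁻ : ∀ {n m} (G : Graph n) (H : Graph m) (σ : G ≅ H) {i j} → Adj H (isoTo σ i) (isoTo σ j) → Adj G i j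
isoAdj⁻ G H (f , e) {i} {j} a = trans (sym (e i j)) a

liftLeaf : ∀ {n m} {G : Graph n} {H : Graph m} (σ : G ≅ H) {a b} → isoTo σ a ≡ b → addLeaf G a ≅ addLeaf H b
liftLeaf {n} {m} {G} {H} (f , e) {a} {b} ab =
  mk↔ₛ′ t fr tf ft , adjOK
  where
  t : Fin (suc n) → Fin (suc m)
  t zero = zero
  t (suc i) = suc (Inverse.to f i)
  fr : Fin (suc m) → Fin (suc n)
  fr zero = zero
  fr (suc i) = suc (Inverse.from f i)
  tf : ∀ y → t (fr y) ≡ y
  tf zero = refl
  tf (suc y) = cong suc (toFrom f y)
  ft : ∀ x → fr (t x) ≡ x
  ft zero = refl
  ft (suc x) = cong suc (fromTo f x)
  key : ∀ j → ⌊ Inverse.to f j ≟ b ⌋ ≡ ⌊ j ≟ a ⌋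
  key j with j ≟ a
  ... | yes refl = subst (λ y → ⌊ Inverse.to f a ≟ y ⌋ ≡ true) ab (≟-refl (Inverse.to f a))
  ... | no q = ≟-false λ p → q (trans (sym (fromTo f j)) (trans (cong (Inverse.from f) (trans p (sym ab))) (fromTo f a)))
  adjOK : ∀ i j → adj (addLeaf H b) (t i) (t j) ≡ adj (addLeaf G a) i j
  adjOK zero zero = refl
  adjOK zero (suc j) = key j
  adjOK (suc i) zero = key i
  adjOK (suc i) (suc j) = e i j

liftPath : ∀ {n m} (G : Graph n) (H : Graph m) (σ : G ≅ H) {a b} → isoTo σ a ≡ b → ∀ k → addPendantPath k G a ≅ addPendantPath k H b
liftPathAux : ∀ {n m} (G : Graph n) (H : Graph m) (σ : G ≅ H) {a b} (ab : isoTo σ a ≡ b) k →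
  isoTo (liftPath G H σ ab k) zero ≡ zero
liftPath G H σ ab zero = liftLeaf {G = G} {H} σ ab
liftPath G H σ {a} {b} ab (suc k) = liftLeaf {G = addPendantPath k G a} {addPendantPath k H b} (liftPath G H σ ab k) (liftPathAux G H σ ab k)
liftPathAux G H σ ab zero = refl
liftPathAux G H σ ab (suc k) = refl

-- Efficient domination.  'Dom G D w v': v is a D-vertex dominating w
-- (v ∈ D, w ∈ N(v)); 'Cov G P w v': v is a P-vertex covering w
-- (v ∈ P, w ∈ N[v]).

Dom : ∀ {n} → Graph n → (Fin n → Bool) → Fin n → Fin n → Set
Dom G D w v = D v ≡ true × Adj G v w

Cov : ∀ {n} → Graph n → (Fin n → Bool) → Fin n → Fin n → Set
Cov G P w v = P v ≡ true × (v ≡ w ⊎ Adj G v w)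

-- These
-- are the intermediate states when a pendant path is built leaf by leaf.
EODMissing : ∀ {n} → Graph n → (Fin n → Bool) → Maybe (Fin n) → Set
EODMissing G D nothing = IsEOD G D
EODMissing G D (just x) = (∀ v → ¬ Dom G D x v) × (∀ w → w ≢ x → ∃! _≡_ (Dom G D w))

ECDMissing : ∀ {n} → Graph n → (Fin n → Bool) → Maybe (Fin n) → Set
ECDMissing G P nothing = IsECD G P
ECDMissing G P (just x) = (∀ v → ¬ Cov G P x v) × (∀ w → w ≢ x → ∃! _≡_ (Cov G P w))

extend : ∀ {n} → Bool → (Fin n → Bool) → Fin (suc n) → Bool
extend b D zero = b
extend b D (suc i) = D i

covUniq : ∀ {n} (G : Graph n) P → IsECD G P → ∀ {w a b} → Cov G P w a → Cov G P w b → a ≡ b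
covUniq G P e {w} ca cb with e w
... | c0 , _ , uq = trans (sym (uq ca)) (uq cb)

domUniq : ∀ {n} (G : Graph n) D → IsEOD G D → ∀ {w a b} → Dom G D w a → Dom G D w b → a ≡ b
domUniq G D e {w} ca cb with e w
... | c0 , _ , uq = trans (sym (uq ca)) (uq cb)

covTransfer : ∀ {n} (G : Graph n) P P1 w → (∀ c → (c ≡ w ⊎ Adj G c w) → P1 c ≡ P c) →
              ∃! _≡_ (Cov G P w) → ∃! _≡_ (Cov G P1 w)
covTransfer G P P1 w ag (c0 , (pc , r) , uq) =
  c0 , (trans (ag c0 r) pc , r) , λ { {y} (py , ry) → uq (trans (sym (ag y ry)) py , ry) }


ecdNeighbourOut : ∀ {n} (G : Graph n) P → IsECD G P → ∀ {a b} → P b ≡ true → Adj G b a → P a ≡ false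
ecdNeighbourOut G P e {a} {b} pb ab = ¬true⇒false λ pa → adjIrr G ab (sym (covUniq G P e (pa , inj₁ refl) (pb , inj₂ ab)))

upd : ∀ {n} → (Fin n → Bool) → Fin n → Bool → Fin n → Bool
upd S a b i = if ⌊ i ≟ a ⌋ then b else S i

upd-eq : ∀ {n} (S : Fin n → Bool) a b → upd S a b a ≡ b
upd-eq S a b rewrite ≟-refl a = refl

upd-ne : ∀ {n} (S : Fin n → Bool) a b i → i ≢ a → upd S a b i ≡ S i
upd-ne S a b i q rewrite ≟-false q = refl

-- An old vertex j keeps its dominator / coverer unless the new leaf becomes
-- one for it, which happens only if b = true and j = u.

module AddLeaf {n} (G : Graph n) (u : Fin n) where
  G' : Graph (suc n)
  G' = addLeaf G u

  oldX : ∀ (S : Fin n → Bool) b j → (b ≡ false ⊎ j ≢ u) →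
         ∀ v → (S v ≡ true × (v ≡ j ⊎ Adj G v j)) → Cov G' (extend b S) (suc j) (suc v)
  oldX S b j c v (s , inj₁ e) = s , inj₁ (cong suc e)
  oldX S b j c v (s , inj₂ a) = s , inj₂ a

  zeroCovOld : ∀ (S : Fin n → Bool) b j → (b ≡ false ⊎ j ≢ u) → ¬ Cov G' (extend b S) (suc j) zero
  zeroCovOld S .false j (inj₁ refl) (() , _)
  zeroCovOld S b j (inj₂ q) (_ , inj₁ ())
  zeroCovOld S b j (inj₂ q) (_ , inj₂ a) = q (≟-true a)

  zeroDomOld : ∀ (S : Fin n → Bool) b j → (b ≡ false ⊎ j ≢ u) → ¬ Dom G' (extend b S) (suc j) zero
  zeroDomOld S b j c (s , a) = zeroCovOld S b j c (s , inj₂ a)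

  oldEOD : ∀ D b j → (b ≡ false ⊎ j ≢ u) → ∃! _≡_ (Dom G D j) → ∃! _≡_ (Dom G' (extend b D) (suc j))
  oldEOD D b j c (v , dv , uq) = suc v , dv , λ { {zero} d → ⊥-elim (zeroDomOld D b j c d) ; {suc y} d → cong suc (uq d) }

  oldECD : ∀ P b j → (b ≡ false ⊎ j ≢ u) → ∃! _≡_ (Cov G P j) → ∃! _≡_ (Cov G' (extend b P) (suc j))
  oldECD P b j c (v , cv , uq) = suc v , oldX P b j c v cv ,
    λ { {zero} d → ⊥-elim (zeroCovOld P b j c d)
      ; {suc y} (py , inj₁ e) → cong suc (uq (py , inj₁ (fsuc-injective e)))
      ; {suc y} (py , inj₂ a) → cong suc (uq (py , inj₂ a)) }

  newDomE : ∀ D b → D u ≡ true → ∃! _≡_ (Dom G' (extend b D) zero)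
  newDomE D b du = suc u , (du , ≟-refl u) , λ { {zero} (_ , ()) ; {suc y} (_ , a) → sym (cong suc (≟-true a)) }

  newDomN : ∀ D b → D u ≡ false → ∀ v → ¬ Dom G' (extend b D) zero v
  newDomN D b du zero (_ , ())
  newDomN D b du (suc v) (dv , a) with ≟-true {i = v} {u} a
  ... | refl = t≢f (trans (sym dv) du)

  newCovE : ∀ P → P u ≡ true → ∃! _≡_ (Cov G' (extend false P) zero)
  newCovE P pu = suc u , (pu , inj₂ (≟-refl u)) ,
    λ { {zero} (() , _) ; {suc y} (_ , inj₁ ()) ; {suc y} (_ , inj₂ a) → sym (cong suc (≟-true a)) }

  newCovN : ∀ P → P u ≡ false → ∀ v → ¬ Cov G' (extend false P) zero v
  newCovN P pu zero (() , _)
  newCovN P pu (suc v) (_ , inj₁ ())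
  newCovN P pu (suc v) (pv , inj₂ a) with ≟-true {i = v} {u} a
  ... | refl = t≢f (trans (sym pv) pu)

  newCovSelf : ∀ P → P u ≡ false → ∃! _≡_ (Cov G' (extend true P) zero)
  newCovSelf P pu = zero , (refl , inj₁ refl) ,
    λ { {zero} _ → refl ; {suc y} (_ , inj₁ ()) ; {suc y} (py , inj₂ a) → ⊥-elim (t≢f (trans (sym py) (trans (cong P (≟-true a)) pu))) }

  -- the four EOD transitions: the new leaf is dominated iff D u; giving it
  -- label true dominates u, which must have been the missing vertex
  eodLeafAtDominator : ∀ D → EODMissing G D nothing → D u ≡ true → EODMissing G' (extend false D) nothing
  eodLeafAtDominator D e du zero = newDomE D false du
  eodLeafAtDominator D e du (suc j) = oldEOD D false j (inj₁ refl) (e j)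

  eodLeafAtNonDominator : ∀ D → EODMissing G D nothing → D u ≡ false → EODMissing G' (extend false D) (just zero)
  eodLeafAtNonDominator D e du = newDomN D false du , λ { zero q → ⊥-elim (q refl) ; (suc j) _ → oldEOD D false j (inj₁ refl) (e j) }

  newAtU : ∀ D → (∀ v → ¬ Dom G D u v) → ∃! _≡_ (Dom G' (extend true D) (suc u))
  newAtU D h = zero , (refl , ≟-refl u) , λ { {zero} _ → refl ; {suc y} d → ⊥-elim (h y d) }

  oldE1 : ∀ D → EODMissing G D (just u) → ∀ j → j ≢ u → ∃! _≡_ (Dom G' (extend true D) (suc j))
  oldE1 D (h , e) j q = oldEOD D true j (inj₂ q) (e j q)

  eodLeafCompletes : ∀ D → EODMissing G D (just u) → D u ≡ true → EODMissing G' (extend true D) nothing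
  eodLeafCompletes D (h , e) du zero = newDomE D true du
  eodLeafCompletes D (h , e) du (suc j) with j ≟ u
  ... | yes refl = newAtU D h
  ... | no q = oldE1 D (h , e) j q

  eodLeafPasses : ∀ D → EODMissing G D (just u) → D u ≡ false → EODMissing G' (extend true D) (just zero)
  eodLeafPasses D (h , e) du = newDomN D true du , λ { zero q → ⊥-elim (q refl) ; (suc j) _ → aux j }
    where
    aux : ∀ j → ∃! _≡_ (Dom G' (extend true D) (suc j))
    aux j with j ≟ u
    ... | yes refl = newAtU D h
    ... | no q = oldE1 D (h , e) j q

  -- the three ECD transitions: the new leaf is covered by u if P u, and
  -- otherwise it must itself join P, which then also covers u
  ecdLeafAtCentre : ∀ P → ECDMissing G P nothing → P u ≡ true → ECDMissing G' (extend false P) nothing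
  ecdLeafAtCentre P e pu zero = newCovE P pu
  ecdLeafAtCentre P e pu (suc j) = oldECD P false j (inj₁ refl) (e j)

  ecdLeafAtNonCentre : ∀ P → ECDMissing G P nothing → P u ≡ false → ECDMissing G' (extend false P) (just zero)
  ecdLeafAtNonCentre P e pu = newCovN P pu , λ { zero q → ⊥-elim (q refl) ; (suc j) _ → oldECD P false j (inj₁ refl) (e j) }

  ecdLeafCompletes : ∀ P → ECDMissing G P (just u) → P u ≡ false → ECDMissing G' (extend true P) nothing
  ecdLeafCompletes P (h , e) pu zero = newCovSelf P pu
  ecdLeafCompletes P (h , e) pu (suc j) with j ≟ u
  ... | yes refl = zero , (refl , inj₂ (≟-refl u)) ,
        λ { {zero} _ → refl ; {suc y} (py , inj₁ e) → ⊥-elim (h y (py , inj₁ (fsuc-injective e))) ; {suc y} (py , inj₂ a) → ⊥-elim (h y (py , inj₂ a)) }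
  ... | no q = oldECD P true j (inj₂ q) (e j q)

EOD-transport : ∀ {n m} (G : Graph n) (H : Graph m) (σ : G ≅ H) D → IsEOD H D → IsEOD G (D ∘ isoTo σ)
EOD-transport G H σ@(f , e) D eod w with eod (isoTo σ w)
... | v , (dv , av) , uq =
  isoFrom σ v ,
  (subst (λ t → D t ≡ true) (sym (toFrom f v)) dv ,
   isoAdj⁻ G H σ (subst (λ t → Adj H t (isoTo σ w)) (sym (toFrom f v)) av)) ,
  λ { {y} (dy , ay) → trans (cong (isoFrom σ) (uq (dy , isoAdj G H σ ay))) (fromTo f y) }

ECD-transport : ∀ {n m} (G : Graph n) (H : Graph m) (σ : G ≅ H) P → IsECD H P → IsECD G (P ∘ isoTo σ)
ECD-transport G H σ@(f , e) P ecd w with ecd (isoTo σ w)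
... | v , (pv , r) , uq =
  isoFrom σ v ,
  (subst (λ t → P t ≡ true) (sym (toFrom f v)) pv , r' r) ,
  λ { {y} (py , inj₁ refl) → trans (cong (isoFrom σ) (uq (py , inj₁ refl))) (fromTo f y)
    ; {y} (py , inj₂ ay) → trans (cong (isoFrom σ) (uq (py , inj₂ (isoAdj G H σ ay)))) (fromTo f y) }
  where
  r' : v ≡ isoTo σ w ⊎ Adj H v (isoTo σ w) → isoFrom σ v ≡ w ⊎ Adj G (isoFrom σ v) w
  r' (inj₁ refl) = inj₁ (fromTo f w)
  r' (inj₂ av) = inj₂ (isoAdj⁻ G H σ (subst (λ t → Adj H t (isoTo σ w)) (sym (toFrom f v)) av))

EOCD-transport : ∀ {n m} (G : Graph n) (H : Graph m) → G ≅ H → IsEOCD H → IsEOCD G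
EOCD-transport G H σ ((D , d) , (P , p)) = (D ∘ isoTo σ , EOD-transport G H σ D d) , (P ∘ isoTo σ , ECD-transport G H σ P p)

k2D : Fin 2 → Bool
k2D _ = true

k2P : Fin 2 → Bool
k2P zero = true
k2P (suc _) = false

k2EOD : IsEOD K2 k2D
k2EOD zero = suc zero , (refl , refl) , λ { {zero} (_ , ()) ; {suc zero} _ → refl }
k2EOD (suc zero) = zero , (refl , refl) , λ { {zero} _ → refl ; {suc zero} (_ , ()) }

k2ECD : IsECD K2 k2P
k2ECD zero = zero , (refl , inj₁ refl) , λ { {zero} _ → refl ; {suc zero} (() , _) }
k2ECD (suc zero) = zero , (refl , inj₂ refl) , λ { {zero} _ → refl ; {suc zero} (() , _) }

-- Let v u x be a path with v a leaf
-- and deg u = 2, and u ∈ P.  Moving the P-label from u to v leaves the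
-- coverage of every vertex unchanged except x, which is now uncovered; a
-- new leaf at x can then join P ('ecdAfterO4').  Similarly for the path
-- u x w z w' x' of O₅, moving the labels of x, w' to w, x' uncovers only
-- the leaf u ('ecdAfterO5').

ecdAfterO4 : ∀ {n} (G : Graph n) P → IsECD G P → ∀ v u x → OnlyNeighbour G v u → TwoNeighbours G u v x → P u ≡ true →
       ∀ P1 → P1 v ≡ true → P1 u ≡ false → (∀ i → i ≢ v → i ≢ u → P1 i ≡ P i) → ECDMissing G P1 (just x)
ecdAfterO4 G P e v u x (avu , ov) (v≢x , auv , aux , tu) pu P1 p1v p1u p1o = none , some
  where
  u≢x : u ≢ x
  u≢x = adjIrr G aux
  px : P x ≡ false
  px = ecdNeighbourOut G P e pu aux
  p1x : P1 x ≡ false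
  p1x = trans (p1o x (λ q → v≢x (sym q)) (λ q → u≢x (sym q))) px
  none : ∀ c → ¬ Cov G P1 x c
  none c (pc , inj₁ refl) = t≢f (trans (sym pc) p1x)
  none c (pc , inj₂ acx) with c ≟ u | c ≟ v
  ... | yes refl | _ = t≢f (trans (sym pc) p1u)
  ... | no _ | yes refl = u≢x (sym (ov x acx))
  ... | no c≢u | no c≢v = c≢u (covUniq G P e (trans (sym (p1o c c≢v c≢u)) pc , inj₂ acx) (pu , inj₂ aux))
  some : ∀ w → w ≢ x → ∃! _≡_ (Cov G P1 w)
  some w w≢x with w ≟ v
  ... | yes refl = v , (p1v , inj₁ refl) ,
        λ { (py , inj₁ e) → sym e ; {y} (py , inj₂ ayv) → ⊥-elim (t≢f (trans (sym py) (trans (cong P1 (ov y (adjSym G ayv))) p1u))) }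
  ... | no w≢v with w ≟ u
  ... | yes refl = v , (p1v , inj₂ avu) , uqU
    where
    uqU : ∀ {y} → Cov G P1 w y → v ≡ y
    uqU (py , inj₁ refl) = ⊥-elim (t≢f (trans (sym py) p1u))
    uqU {y} (py , inj₂ ayu) with tu y (adjSym G ayu)
    ... | inj₁ e = sym e
    ... | inj₂ refl = ⊥-elim (t≢f (trans (sym py) p1x))
  ... | no w≢u = covTransfer G P P1 w ag (e w)
    where
    ag : ∀ c → (c ≡ w ⊎ Adj G c w) → P1 c ≡ P c
    ag c (inj₁ refl) = p1o c w≢v w≢u
    ag c (inj₂ acw) with c ≟ v | c ≟ u
    ... | yes refl | _ = ⊥-elim (w≢u (ov w acw))
    ... | no _ | yes refl = ⊥-elim ([ w≢v , w≢x ]′ (tu w acw))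
    ... | no c≢v | no c≢u = p1o c c≢v c≢u


ecdAfterO5 : ∀ {n} (G : Graph n) P → IsECD G P → ∀ u x w z w' x' →
       Unique (u ∷ x ∷ w ∷ z ∷ w' ∷ x' ∷ []) →
       OnlyNeighbour G u x → TwoNeighbours G x u w → TwoNeighbours G w x z → TwoNeighbours G w' z x' → OnlyNeighbour G x' w' →
       P x ≡ true → P w' ≡ true →
       ∀ P1 → P1 x ≡ false → P1 w' ≡ false → P1 w ≡ true → P1 x' ≡ true →
       (∀ i → i ≢ x → i ≢ w' → i ≢ w → i ≢ x' → P1 i ≡ P i) → ECDMissing G P1 (just u)
ecdAfterO5 G P e u x w z w' x'
  ((u≢x ∷ u≢w ∷ u≢z ∷ u≢w' ∷ u≢x' ∷ []) ∷ (x≢w ∷ x≢z ∷ x≢w' ∷ x≢x' ∷ []) ∷ (w≢z ∷ w≢w' ∷ w≢x' ∷ []) ∷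
   (z≢w' ∷ z≢x' ∷ []) ∷ (w'≢x' ∷ []) ∷ [] ∷ [])
  (aux , ou) (_ , axu , axw , tx) (_ , awx , awz , tw) (_ , aw'z , aw'x' , tw') (ax'w' , ox')
  px pw' P1 p1x p1w' p1w p1x' p1o = none , some
  where
  pu : P u ≡ false
  pu = ecdNeighbourOut G P e px axu
  pz : P z ≡ false
  pz = ecdNeighbourOut G P e pw' aw'z
  p1u : P1 u ≡ false
  p1u = trans (p1o u u≢x u≢w' u≢w u≢x') pu
  p1z : P1 z ≡ false
  p1z = trans (p1o z (≢-sym x≢z) z≢w' (≢-sym w≢z) z≢x') pz
  none : ∀ c → ¬ Cov G P1 u c
  none c (pc , inj₁ refl) = clash pc p1u
  none c (pc , inj₂ acu) with ou c (adjSym G acu)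
  ... | refl = clash pc p1x
  some : ∀ y → y ≢ u → ∃! _≡_ (Cov G P1 y)
  some y y≢u with y ≟ x
  ... | yes refl = w , (p1w , inj₂ awx) , uq
    where
    uq : ∀ {c} → Cov G P1 y c → w ≡ c
    uq (pc , inj₁ refl) = ⊥-elim (clash pc p1x)
    uq {c} (pc , inj₂ acx) with tx c (adjSym G acx)
    ... | inj₁ refl = ⊥-elim (clash pc p1u)
    ... | inj₂ e = sym e
  ... | no y≢x with y ≟ w
  ... | yes refl = w , (p1w , inj₁ refl) , uq
    where
    uq : ∀ {c} → Cov G P1 y c → w ≡ c
    uq (pc , inj₁ e) = sym e
    uq {c} (pc , inj₂ acw) with tw c (adjSym G acw)
    ... | inj₁ refl = ⊥-elim (clash pc p1x)
    ... | inj₂ refl = ⊥-elim (clash pc p1z)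
  ... | no y≢w with y ≟ z
  ... | yes refl = w , (p1w , inj₂ awz) , uq
    where
    uq : ∀ {c} → Cov G P1 y c → w ≡ c
    uq (pc , inj₁ refl) = ⊥-elim (clash pc p1z)
    uq {c} (pc , inj₂ acz) with c ≟ w | c ≟ w' | c ≟ x | c ≟ x'
    ... | yes e | _ | _ | _ = sym e
    ... | no _ | yes refl | _ | _ = ⊥-elim (clash pc p1w')
    ... | no _ | no _ | yes refl | _ = ⊥-elim ([ u≢z ∘ sym , w≢z ∘ sym ]′ (tx z acz))
    ... | no _ | no _ | no _ | yes refl = ⊥-elim (z≢w' (ox' z acz))
    ... | no c≢w | no c≢w' | no c≢x | no c≢x' =
          ⊥-elim (c≢w' (covUniq G P e (trans (sym (p1o c c≢x c≢w' c≢w c≢x')) pc , inj₂ acz) (pw' , inj₂ aw'z)))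
  ... | no y≢z with y ≟ w'
  ... | yes refl = x' , (p1x' , inj₂ ax'w') , uq
    where
    uq : ∀ {c} → Cov G P1 y c → x' ≡ c
    uq (pc , inj₁ refl) = ⊥-elim (clash pc p1w')
    uq {c} (pc , inj₂ acw') with tw' c (adjSym G acw')
    ... | inj₁ refl = ⊥-elim (clash pc p1z)
    ... | inj₂ e = sym e
  ... | no y≢w' with y ≟ x'
  ... | yes refl = x' , (p1x' , inj₁ refl) , uq
    where
    uq : ∀ {c} → Cov G P1 y c → x' ≡ c
    uq (pc , inj₁ e) = sym e
    uq {c} (pc , inj₂ acx') with ox' c (adjSym G acx')
    ... | refl = ⊥-elim (clash pc p1w')
  ... | no y≢x' = covTransfer G P P1 y ag (e y)
    where
    ag : ∀ c → (c ≡ y ⊎ Adj G c y) → P1 c ≡ P c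
    ag c (inj₁ refl) = p1o c y≢x y≢w' y≢w y≢x'
    ag c (inj₂ acy) with c ≟ x | c ≟ w' | c ≟ w | c ≟ x'
    ... | yes refl | _ | _ | _ = ⊥-elim ([ y≢u , y≢w ]′ (tx y acy))
    ... | no _ | yes refl | _ | _ = ⊥-elim ([ y≢z , y≢x' ]′ (tw' y acy))
    ... | no _ | no _ | yes refl | _ = ⊥-elim ([ y≢x , y≢z ]′ (tw y acy))
    ... | no _ | no _ | no _ | yes refl = ⊥-elim (y≢w' (ox' y acy))
    ... | no a | no b | no c' | no d = p1o c a b c' d

-- The converse shifts, used when a configuration is reduced: removing the
-- leaf y at x (resp. the leaf v at u) from a tree with ECD set P, a
-- modified labelling P1 covers every remaining vertex exactly once.
module _ {n} (T : Graph n) (P : Fin n → Bool) (eP : IsECD T P) where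

  ecdBeforeO4 : ∀ P1 y x u v → OnlyNeighbour T y x → TwoNeighbours T u v x → OnlyNeighbour T v u → P y ≡ true →
         P1 u ≡ true → P1 v ≡ false → P1 y ≡ false → P1 x ≡ false → (∀ i → i ≢ u → i ≢ v → i ≢ y → P1 i ≡ P i) →
         ∀ s' → s' ≢ y → ∃! _≡_ (Cov T P1 s')
  ecdBeforeO4 P1 y x u v (ayx , qy) (v≢x , auv , aux , qu) (avu , qv) py p1u p1v p1y p1x p1o s' s'≢y
    with s' ≟ v | s' ≟ u | s' ≟ x
  ... | yes refl | _ | _ = u , (p1u , inj₂ auv) , uq
    where
    uq : ∀ {c} → Cov T P1 s' c → u ≡ c
    uq (pc , inj₁ refl) = ⊥-elim (clash pc p1v)
    uq {c} (pc , inj₂ a) = sym (qv c (adjSym T a))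
  ... | no _ | yes refl | _ = u , (p1u , inj₁ refl) , uq
    where
    uq : ∀ {c} → Cov T P1 s' c → u ≡ c
    uq (pc , inj₁ e) = sym e
    uq {c} (pc , inj₂ a) with qu c (adjSym T a)
    ... | inj₁ refl = ⊥-elim (clash pc p1v)
    ... | inj₂ refl = ⊥-elim (clash pc p1x)
  ... | no _ | no _ | yes refl = u , (p1u , inj₂ aux) , uq
    where
    uq : ∀ {c} → Cov T P1 s' c → u ≡ c
    uq (pc , inj₁ refl) = ⊥-elim (clash pc p1x)
    uq {c} (pc , inj₂ a) with c ≟ u | c ≟ y | c ≟ v
    ... | yes e | _ | _ = sym e
    ... | no _ | yes refl | _ = ⊥-elim (clash pc p1y)
    ... | no _ | no _ | yes refl = ⊥-elim (adjIrr T aux (sym (qv s' a)))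
    ... | no c≢u | no c≢y | no c≢v = ⊥-elim (c≢y (covUniq T P eP (trans (sym (p1o c c≢u c≢v c≢y)) pc , inj₂ a) (py , inj₂ ayx)))
  ... | no s'≢v | no s'≢u | no s'≢x = covTransfer T P P1 s' ag (eP s')
    where
    ag : ∀ c → (c ≡ s' ⊎ Adj T c s') → P1 c ≡ P c
    ag c (inj₁ refl) = p1o c s'≢u s'≢v s'≢y
    ag c (inj₂ a) with c ≟ u | c ≟ v | c ≟ y
    ... | yes refl | _ | _ = ⊥-elim ([ s'≢v , s'≢x ]′ (qu s' a))
    ... | no _ | yes refl | _ = ⊥-elim (s'≢u (qv s' a))
    ... | no _ | no _ | yes refl = ⊥-elim (s'≢x (qy s' a))
    ... | no a1 | no a2 | no a3 = p1o c a1 a2 a3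

  ecdBeforeO5 : ∀ P1 v u x w z w' x' → OnlyNeighbour T v u → TwoNeighbours T u x v → TwoNeighbours T x w u → TwoNeighbours T w z x →
         TwoNeighbours T w' z x' → OnlyNeighbour T x' w' → P w ≡ true →
         u ≢ z → x ≢ z → w ≢ z → v ≢ z → z ≢ w' →
         P1 x ≡ true → P1 w' ≡ true → P1 u ≡ false → P1 v ≡ false → P1 w ≡ false → P1 z ≡ false → P1 x' ≡ false →
         (∀ i → i ≢ v → i ≢ w → i ≢ x' → i ≢ x → i ≢ w' → P1 i ≡ P i) →
         ∀ s' → s' ≢ v → ∃! _≡_ (Cov T P1 s')
  ecdBeforeO5 P1 v u x w z w' x' (avu , qv) (x≢v , aux , auv , qu) (w≢u , axw , axu , qx) (z≢x , awz , awx , qw)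
       (z≢x' , aw'z , aw'x' , qw') (ax'w' , qx') pw u≢z x≢z w≢z v≢z z≢w' p1x p1w' p1u p1v p1w p1z p1x' p1o s' s'≢v
    with s' ≟ u | s' ≟ x | s' ≟ w | s' ≟ z | s' ≟ w' | s' ≟ x'
  ... | yes refl | _ | _ | _ | _ | _ = x , (p1x , inj₂ (adjSym T aux)) , uq
    where
    uq : ∀ {c} → Cov T P1 s' c → x ≡ c
    uq (pc , inj₁ refl) = ⊥-elim (clash pc p1u)
    uq {c} (pc , inj₂ a) with qu c (adjSym T a)
    ... | inj₁ e = sym e
    ... | inj₂ refl = ⊥-elim (clash pc p1v)
  ... | no _ | yes refl | _ | _ | _ | _ = x , (p1x , inj₁ refl) , uq
    where
    uq : ∀ {c} → Cov T P1 s' c → x ≡ c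
    uq (pc , inj₁ e) = sym e
    uq {c} (pc , inj₂ a) with qx c (adjSym T a)
    ... | inj₁ refl = ⊥-elim (clash pc p1w)
    ... | inj₂ refl = ⊥-elim (clash pc p1u)
  ... | no _ | no _ | yes refl | _ | _ | _ = x , (p1x , inj₂ axw) , uq
    where
    uq : ∀ {c} → Cov T P1 s' c → x ≡ c
    uq (pc , inj₁ refl) = ⊥-elim (clash pc p1w)
    uq {c} (pc , inj₂ a) with qw c (adjSym T a)
    ... | inj₁ refl = ⊥-elim (clash pc p1z)
    ... | inj₂ e = sym e
  ... | no _ | no _ | no _ | yes refl | _ | _ = w' , (p1w' , inj₂ aw'z) , uq
    where
    uq : ∀ {c} → Cov T P1 s' c → w' ≡ c
    uq (pc , inj₁ refl) = ⊥-elim (clash pc p1z)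
    uq {c} (pc , inj₂ a) with c ≟ w' | c ≟ w | c ≟ x | c ≟ x' | c ≟ v | c ≟ u
    ... | yes e | _ | _ | _ | _ | _ = sym e
    ... | no _ | yes refl | _ | _ | _ | _ = ⊥-elim (clash pc p1w)
    ... | no _ | no _ | yes refl | _ | _ | _ = ⊥-elim ([ (λ e → w≢z (sym e)) , (λ e → u≢z (sym e)) ]′ (qx s' a))
    ... | no _ | no _ | no _ | yes refl | _ | _ = ⊥-elim (z≢w' (qx' s' a))
    ... | no _ | no _ | no _ | no _ | yes refl | _ = ⊥-elim (u≢z (sym (qv s' a)))
    ... | no _ | no _ | no _ | no _ | no _ | yes refl = ⊥-elim ([ (λ e → x≢z (sym e)) , (λ e → v≢z (sym e)) ]′ (qu s' a))
    ... | no c≢w' | no c≢w | no c≢x | no c≢x' | no c≢v | no _ =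
          ⊥-elim (c≢w (covUniq T P eP (trans (sym (p1o c c≢v c≢w c≢x' c≢x c≢w')) pc , inj₂ a) (pw , inj₂ awz)))
  ... | no _ | no _ | no _ | no _ | yes refl | _ = w' , (p1w' , inj₁ refl) , uq
    where
    uq : ∀ {c} → Cov T P1 s' c → w' ≡ c
    uq (pc , inj₁ e) = sym e
    uq {c} (pc , inj₂ a) with qw' c (adjSym T a)
    ... | inj₁ refl = ⊥-elim (clash pc p1z)
    ... | inj₂ refl = ⊥-elim (clash pc p1x')
  ... | no _ | no _ | no _ | no _ | no _ | yes refl = w' , (p1w' , inj₂ aw'x') , uq
    where
    uq : ∀ {c} → Cov T P1 s' c → w' ≡ c
    uq (pc , inj₁ refl) = ⊥-elim (clash pc p1x')
    uq {c} (pc , inj₂ a) = sym (qx' c (adjSym T a))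
  ... | no s≢u | no s≢x | no s≢w | no s≢z | no s≢w' | no s≢x' = covTransfer T P P1 s' ag (eP s')
    where
    ag : ∀ c → (c ≡ s' ⊎ Adj T c s') → P1 c ≡ P c
    ag c (inj₁ refl) = p1o c s'≢v s≢w s≢x' s≢x s≢w'
    ag c (inj₂ a) with c ≟ v | c ≟ w | c ≟ x' | c ≟ x | c ≟ w'
    ... | yes refl | _ | _ | _ | _ = ⊥-elim (s≢u (qv s' a))
    ... | no _ | yes refl | _ | _ | _ = ⊥-elim ([ s≢z , s≢x ]′ (qw s' a))
    ... | no _ | no _ | yes refl | _ | _ = ⊥-elim (s≢w' (qx' s' a))
    ... | no _ | no _ | no _ | yes refl | _ = ⊥-elim ([ s≢w , s≢u ]′ (qx s' a))
    ... | no _ | no _ | no _ | no _ | yes refl = ⊥-elim ([ s≢z , s≢x' ]′ (qw' s' a))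
    ... | no a1 | no a2 | no a3 | no a4 | no a5 = p1o c a1 a2 a3 a4 a5

module _ {n} {G : Graph n} {D P : Subset n} (eD : IsEOD G D) (eP : IsECD G P) where
  open AddLeaf

  eocdO1 : ∀ u → D u ≡ true → P u ≡ true → IsEOCD (addLeaf G u)
  eocdO1 u du pu =
    (extend false D , eodLeafAtDominator G u D eD du) , (extend false P , ecdLeafAtCentre G u P eP pu)

  -- O₂: the path w x u v is labelled D = (-, -, +, +), and P according to P w
  eocdO2 : ∀ w → D w ≡ false → IsEOCD (addPendantPath 2 G w)
  eocdO2 w dw = (D' , eD') , P'
    where
    G1 = addLeaf G w
    G2 = addLeaf G1 zero
    D' = extend true (extend true (extend false D))
    eD' : IsEOD (addPendantPath 2 G w) D'
    eD' = eodLeafCompletes G2 zero (extend true (extend false D))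
            (eodLeafPasses G1 zero (extend false D) (eodLeafAtNonDominator G w D eD dw) refl) refl
    P' : ∃ λ P' → IsECD (addPendantPath 2 G w) P'
    P' with P w in pw
    ... | false = extend false (extend true (extend false P)) ,
                  ecdLeafAtCentre G2 zero (extend true (extend false P))
                    (ecdLeafCompletes G1 zero (extend false P) (ecdLeafAtNonCentre G w P eP pw) refl) refl
    ... | true = extend true (extend false (extend false P)) ,
                 ecdLeafCompletes G2 zero (extend false (extend false P))
                   (ecdLeafAtNonCentre G1 zero (extend false P) (ecdLeafAtCentre G w P eP pw) refl) refl

  -- O₃: the path z w x u v is labelled D = (-, -, +, +, -), P = (-, +, -, -, +)
  eocdO3 : ∀ t → D t ≡ true → P t ≡ false → IsEOCD (addPendantPath 4 G t)
  eocdO3 t dt pt = (D' , eD') , (P' , eP')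
    where
    G1 = addLeaf G t
    G2 = addLeaf G1 zero
    G3 = addLeaf G2 zero
    G4 = addLeaf G3 zero
    D' = extend false (extend true (extend true (extend false (extend false D))))
    eD' : IsEOD (addPendantPath 4 G t) D'
    eD' = eodLeafAtDominator G4 zero _ (eodLeafCompletes G3 zero _ (eodLeafPasses G2 zero _
            (eodLeafAtNonDominator G1 zero _ (eodLeafAtDominator G t D eD dt) refl) refl) refl) refl
    P' = extend true (extend false (extend false (extend true (extend false P))))
    eP' : IsECD (addPendantPath 4 G t) P'
    eP' = ecdLeafCompletes G4 zero _ (ecdLeafAtNonCentre G3 zero _ (ecdLeafAtCentre G2 zero _
            (ecdLeafCompletes G1 zero _ (ecdLeafAtNonCentre G t P eP pt) refl) refl) refl) refl

  -- O₄: shift P from u to v, then the new leaf y at x joins P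
  eocdO4 : ∀ v u x → OnlyNeighbour G v u → TwoNeighbours G u v x → D x ≡ true → P u ≡ true →
           IsEOCD (addLeaf G x)
  eocdO4 v u x ov tu@(v≢x , _ , aux , _) dx pu =
    (extend false D , eodLeafAtDominator G x D eD dx) , (extend true P1 , ecdLeafCompletes G x P1 shifted p1x)
    where
    v≢u = adjIrr G (proj₁ ov)
    u≢x = adjIrr G aux
    Pa = upd P u false
    P1 = upd Pa v true
    shifted : ECDMissing G P1 (just x)
    shifted = ecdAfterO4 G P eP v u x ov tu pu P1 (upd-eq Pa v true)
                (trans (upd-ne Pa v true u (≢-sym v≢u)) (upd-eq P u false))
                (λ i i≢v i≢u → trans (upd-ne Pa v true i i≢v) (upd-ne P u false i i≢u))
    p1x : P1 x ≡ false
    p1x = trans (upd-ne Pa v true x (≢-sym v≢x))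
            (trans (upd-ne P u false x (≢-sym u≢x)) (ecdNeighbourOut G P eP pu aux))

  -- O₅: shift P from x, w' to w, x', then the new leaf v at u joins P
  eocdO5 : ∀ u x w z w' x' → Unique (u ∷ x ∷ w ∷ z ∷ w' ∷ x' ∷ []) →
           OnlyNeighbour G u x → TwoNeighbours G x u w → TwoNeighbours G w x z →
           TwoNeighbours G w' z x' → OnlyNeighbour G x' w' →
           D u ≡ true → P x ≡ true → P w' ≡ true → IsEOCD (addLeaf G u)
  eocdO5 u x w z w' x'
      uq@((u≢x ∷ u≢w ∷ u≢z ∷ u≢w' ∷ u≢x' ∷ []) ∷ (x≢w ∷ x≢z ∷ x≢w' ∷ x≢x' ∷ []) ∷ (w≢z ∷ w≢w' ∷ w≢x' ∷ []) ∷
          (z≢w' ∷ z≢x' ∷ []) ∷ (w'≢x' ∷ []) ∷ [] ∷ [])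
      ou tx tw tw' ox' du px pw' =
    (extend false D , eodLeafAtDominator G u D eD du) , (extend true P1 , ecdLeafCompletes G u P1 shifted p1u)
    where
    Pa = upd P x false
    Pb = upd Pa w' false
    Pc = upd Pb w true
    P1 = upd Pc x' true
    shifted : ECDMissing G P1 (just u)
    shifted =
      ecdAfterO5 G P eP u x w z w' x' uq ou tx tw tw' ox' px pw' P1
        (trans (upd-ne Pc x' true x x≢x') (trans (upd-ne Pb w true x x≢w) (trans (upd-ne Pa w' false x x≢w') (upd-eq P x false))))
        (trans (upd-ne Pc x' true w' w'≢x') (trans (upd-ne Pb w true w' (≢-sym w≢w')) (upd-eq Pa w' false)))
        (trans (upd-ne Pc x' true w w≢x') (upd-eq Pb w true))
        (upd-eq Pc x' true)
        (λ i a b c d → trans (upd-ne Pc x' true i d) (trans (upd-ne Pb w true i c) (trans (upd-ne Pa w' false i b) (upd-ne P x false i a))))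
    p1u : P1 u ≡ false
    p1u =
      trans (upd-ne Pc x' true u u≢x') (trans (upd-ne Pb w true u u≢w) (trans (upd-ne Pa w' false u u≢w')
        (trans (upd-ne P x false u u≢x) (ecdNeighbourOut G P eP px (adjSym G (proj₁ ou))))))

gen⇒EOCD : ∀ {n} {G : Graph n} → Gen G → IsEOCD G
gen⇒EOCD base = (k2D , k2EOD) , (k2P , k2ECD)
gen⇒EOCD (O1 g D P eD eP u du pu) = eocdO1 eD eP u du pu
gen⇒EOCD (O2 g D P eD eP w dw) = eocdO2 eD eP w dw
gen⇒EOCD (O3 g D P eD eP t dt pt) = eocdO3 eD eP t dt pt
gen⇒EOCD (O4 {T = G} g D P eD eP v u x v≢u v≢x u≢x avu aux dv du Du Dx Pu) =
  eocdO4 eD eP v u x (deg1Nb G v u dv avu) (deg2Nb G u v x du (adjSym G avu) aux v≢x) Dx Pu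
gen⇒EOCD (O5 {T = G} g D P eD eP u x w z w' x' uq@((_ ∷ u≢w ∷ _) ∷ (_ ∷ x≢z ∷ _) ∷ _ ∷ (_ ∷ z≢x' ∷ _) ∷ _)
    (a1 ∷ a2 ∷ a3 ∷ a4 ∷ a5 ∷ [-]) du dx' dx dw dw' Du Dx Dw' Dx' Px Pw') =
  eocdO5 eD eP u x w z w' x' uq (deg1Nb G u x du a1)
    (deg2Nb G x u w dx (adjSym G a1) a2 u≢w)
    (deg2Nb G w x z dw (adjSym G a2) a3 x≢z)
    (deg2Nb G w' z x' dw' (adjSym G a4) a5 z≢x')
    (deg1Nb G x' w' dx' (adjSym G a5)) Du Px Pw'

obtainable⇒EOCD : ∀ {n} (T : Graph n) → Obtainable T → IsEOCD T
obtainable⇒EOCD T (m , G , g , σ) = EOCD-transport T G (isoSym {G = G} {T} σ) (gen⇒EOCD g)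

fin⇒pos : ∀ {n} → Fin n → 1 ≤ n
fin⇒pos {suc n} _ = s≤s z≤n

pos⇒fin : ∀ {n} → 1 ≤ n → Fin n
pos⇒fin {suc n} _ = zero

cycMap : ∀ {n m} (G : Graph n) (H : Graph m) (f : Fin n → Fin m) → (∀ {a b} → f a ≡ f b → a ≡ b) →
         (∀ {a b} → Adj G a b → Adj H (f a) (f b)) → ∀ v xs → IsCycle G v xs → IsCycle H (f v) (map f xs)
cycMap G H f inj hom v xs (len , uq , lk) =
  subst (2 ≤_) (sym (length-map f xs)) len ,
  UniqueP.map⁺ inj uq ,
  subst (Linked.Linked (Adj H)) (cong (f v ∷_) (map-++ f xs [ v ])) (LinkedP.map⁺ (Linked.map hom lk))

acycPull : ∀ {n m} (G : Graph n) (H : Graph m) (f : Fin n → Fin m) → (∀ {a b} → f a ≡ f b → a ≡ b) →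
           (∀ {a b} → Adj G a b → Adj H (f a) (f b)) → Acyclic H → Acyclic G
acycPull G H f inj hom ac v xs c = ac (f v) (map f xs) (cycMap G H f inj hom v xs c)

reachMap : ∀ {n m} (G : Graph n) (H : Graph m) (f : Fin n → Fin m) →
           (∀ {a b} → Adj G a b → Adj H (f a) (f b)) → ∀ {a b} → Reach G a b → Reach H (f a) (f b)
reachMap G H f hom here = here
reachMap G H f hom (step a r) = step (hom a) (reachMap G H f hom r)

tree-transport : ∀ {n m} (G : Graph n) (H : Graph m) → G ≅ H → IsTree G → IsTree H
tree-transport G H σ (pos , conn , ac) =
  fin⇒pos (isoTo σ (pos⇒fin pos)) ,
  (λ a b → subst₂ (Reach H) (toFrom (proj₁ σ) a) (toFrom (proj₁ σ) b)
             (reachMap G H (isoTo σ) (isoAdj G H σ) (conn (isoFrom σ a) (isoFrom σ b)))) ,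
  acycPull H G (isoFrom σ) (fromInj (proj₁ σ)) hom ac
  where
  hom : ∀ {a b} → Adj H a b → Adj G (isoFrom σ a) (isoFrom σ b)
  hom {a} {b} x = isoAdj⁻ G H σ (subst₂ (Adj H) (sym (toFrom (proj₁ σ) a)) (sym (toFrom (proj₁ σ) b)) x)

module _ {n} (G : Graph n) (u : Fin n) where
  private G' = addLeaf G u

  reachDown : ∀ {a b} → Reach G' (suc a) (suc b) → Reach G a b
  reachDown here = here
  reachDown (step {w = suc w} x r) = step x (reachDown r)
  reachDown (step {w = zero} x (step {w = zero} y r)) = ⊥-elim (t≢f (sym y))
  reachDown {a} (step {w = zero} x (step {w = suc w} y r))
    with ≟-true {i = a} {u} x | ≟-true {i = w} {u} y
  ... | refl | refl = reachDown r

  treeDown : IsTree G' → IsTree G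
  treeDown (_ , conn , ac) = fin⇒pos u , (λ a b → reachDown (conn (suc a) (suc b))) ,
    acycPull G G' suc fsuc-injective (λ x → x) ac

Ind : ∀ {n m} → Graph n → (Fin m → Fin n) → Graph m
Ind G ι = record { adj = λ i j → adj G (ι i) (ι j) ; sym = λ i j → Graph.sym G (ι i) (ι j) ; irrefl = λ i → Graph.irrefl G (ι i) }

module Peel {m} (T : Graph (suc m)) (ℓ u : Fin (suc m)) (ol : OnlyNeighbour T ℓ u) where
  ℓ≢u : ℓ ≢ u
  ℓ≢u = adjIrr T (proj₁ ol)
  T1 : Graph m
  T1 = Ind T (punchIn ℓ)
  u1 : Fin m
  u1 = punchOut ℓ≢u
  pu1 : punchIn ℓ u1 ≡ u
  pu1 = punchIn-punchOut ℓ≢u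

  to : Fin (suc m) → Fin (suc m)
  to zero = ℓ
  to (suc i) = punchIn ℓ i
  from : Fin (suc m) → Fin (suc m)
  from y with ℓ ≟ y
  ... | yes _ = zero
  ... | no q = suc (punchOut q)
  tf : ∀ y → to (from y) ≡ y
  tf y with ℓ ≟ y
  ... | yes e = e
  ... | no q = punchIn-punchOut q
  ft : ∀ x → from (to x) ≡ x
  ft zero with ℓ ≟ ℓ
  ... | yes _ = refl
  ... | no q = ⊥-elim (q refl)
  ft (suc i) with ℓ ≟ punchIn ℓ i
  ... | yes e = ⊥-elim (punchInᵢ≢i ℓ i (sym e))
  ... | no q = cong suc (trans (punchOut-cong ℓ refl) (punchOut-punchIn ℓ))

  key : ∀ j → adj T ℓ (punchIn ℓ j) ≡ ⌊ j ≟ u1 ⌋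
  key j with j ≟ u1
  ... | yes refl = trans (cong (adj T ℓ) pu1) (proj₁ ol)
  ... | no q with adj T ℓ (punchIn ℓ j) in e
  ... | false = refl
  ... | true = ⊥-elim (q (punchIn-injective ℓ j u1 (trans (proj₂ ol _ e) (sym pu1))))

  σ : addLeaf T1 u1 ≅ T
  σ = mk↔ₛ′ to from tf ft , ad
    where
    ad : ∀ i j → adj T (to i) (to j) ≡ adj (addLeaf T1 u1) i j
    ad zero zero = Graph.irrefl T ℓ
    ad zero (suc j) = key j
    ad (suc i) zero = trans (Graph.sym T (punchIn ℓ i) ℓ) (key i)
    ad (suc i) (suc j) = refl


Emb : ∀ {m n} → Graph m → Graph n → (Fin m → Fin n) → Set
Emb {m} T1 T ι = (∀ {a b} → ι a ≡ ι b → a ≡ b) × (∀ i j → adj T1 i j ≡ adj T (ι i) (ι j))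

embComp : ∀ {k m n} (T2 : Graph k) (T1 : Graph m) (T : Graph n) κ ι → Emb T2 T1 κ → Emb T1 T ι → Emb T2 T (ι ∘ κ)
embComp T2 T1 T κ ι (i2 , a2) (i1 , a1) = (λ e → i2 (i1 e)) , λ i j → trans (a2 i j) (a1 (κ i) (κ j))

module EmbL {m n} (T1 : Graph m) (T : Graph n) (ι : Fin m → Fin n) (emb : Emb T1 T ι) where
  inj = proj₁ emb
  ad = proj₂ emb

  adjE : ∀ {a b} → Adj T (ι a) (ι b) → Adj T1 a b
  adjE {a} {b} x = trans (ad a b) x

  adjE⁻ : ∀ {a b} → Adj T1 a b → Adj T (ι a) (ι b)
  adjE⁻ {a} {b} x = trans (sym (ad a b)) x

  adjE' : ∀ {a b a' b'} → ι a' ≡ a → ι b' ≡ b → Adj T a b → Adj T1 a' b'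
  adjE' refl refl x = adjE x

  oneE : ∀ {a b a' b'} → ι a' ≡ a → ι b' ≡ b → OnlyNeighbour T a b → OnlyNeighbour T1 a' b'
  oneE refl refl (x , q) = adjE x , λ y ay → inj (q (ι y) (adjE⁻ ay))

  twoE : ∀ {a b c a' b' c'} → ι a' ≡ a → ι b' ≡ b → ι c' ≡ c → TwoNeighbours T a b c → TwoNeighbours T1 a' b' c'
  twoE refl refl refl (b≢c , x , y , q) = (λ e → b≢c (cong ι e)) , adjE x , adjE y ,
    λ z az → Sum.map inj inj (q (ι z) (adjE⁻ az))

  restrictD : ∀ D → (∀ w → ∃! _≡_ (Dom T D (ι w))) → (∀ w v → Dom T D (ι w) v → Σ (Fin m) λ v' → ι v' ≡ v) →
              IsEOD T1 (D ∘ ι)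
  restrictD D ex im w with ex w
  ... | v , dv@(d , a) , uq with im w v dv
  ... | v' , refl = v' , (d , adjE a) , λ { {y} (dy , ay) → inj (uq (dy , adjE⁻ ay)) }

  restrictP : ∀ P → (∀ w → ∃! _≡_ (Cov T P (ι w))) → (∀ w v → Cov T P (ι w) v → Σ (Fin m) λ v' → ι v' ≡ v) →
              IsECD T1 (P ∘ ι)
  restrictP P ex im w with ex w
  ... | v , cv@(d , r) , uq with im w v cv
  ... | v' , refl = v' , (d , r' r) , uq'
    where
    r' : ι v' ≡ ι w ⊎ Adj T (ι v') (ι w) → v' ≡ w ⊎ Adj T1 v' w
    r' (inj₁ e) = inj₁ (inj e)
    r' (inj₂ a) = inj₂ (adjE a)
    uq' : ∀ {y} → (P (ι y) ≡ true × (y ≡ w ⊎ Adj T1 y w)) → v' ≡ y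
    uq' (dy , inj₁ refl) = inj (uq (dy , inj₁ refl))
    uq' (dy , inj₂ ay) = inj (uq (dy , inj₂ (adjE⁻ ay)))

isoEmb : ∀ {m n} (T1 : Graph m) (T : Graph n) u1 (σ : addLeaf T1 u1 ≅ T) → Emb T1 T (isoTo σ ∘ suc)
isoEmb T1 T u1 σ = (λ e → fsuc-injective (toInj (proj₁ σ) e)) , λ i j → sym (proj₂ σ (suc i) (suc j))

-- the result of peeling the leaf ℓ (hanging at u) off T, in a form that
-- forgets the concrete construction
record Peeled {n} (T : Graph n) (ℓ u : Fin n) : Set where
  field
    m : ℕ
    eq : n ≡ suc m
    T1 : Graph m
    u1 : Fin m
    σ : addLeaf T1 u1 ≅ T
    σ0 : isoTo σ zero ≡ ℓ
    σu : isoTo σ (suc u1) ≡ u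
  ι : Fin m → Fin n
  ι = isoTo σ ∘ suc
  emb : Emb T1 T ι
  emb = isoEmb T1 T u1 σ
  surj : ∀ y → y ≢ ℓ → Σ (Fin m) λ y' → ι y' ≡ y
  surj y q with isoFrom σ y in e
  ... | zero = ⊥-elim (q (trans (sym (toFrom (proj₁ σ) y)) (trans (cong (isoTo σ) e) σ0)))
  ... | suc y' = y' , trans (cong (isoTo σ) (sym e)) (toFrom (proj₁ σ) y)
  ιne : ∀ y → ι y ≢ ℓ
  ιne y e with toInj (proj₁ σ) (trans e (sym σ0))
  ... | ()
  tree1 : IsTree T → IsTree T1
  tree1 tr = treeDown T1 u1 (tree-transport T (addLeaf T1 u1) (isoSym {G = addLeaf T1 u1} {T} σ) tr)

peel : ∀ {n} (T : Graph n) ℓ u → OnlyNeighbour T ℓ u → Peeled T ℓ u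
peel {suc m} T ℓ u ol = record
  { m = m ; eq = refl ; T1 = P.T1 ; u1 = P.u1 ; σ = P.σ ; σ0 = refl ; σu = P.pu1 }
  where module P = Peel T ℓ u ol

obtainable-transport : ∀ {a b} (A : Graph a) (B : Graph b) → Obtainable A → A ≅ B → Obtainable B
obtainable-transport A B (m , G , g , σ) τ = m , G , g , isoTrans {G = G} {A} {B} σ τ

isoEmb' : ∀ {m n} (G : Graph m) (H : Graph n) (σ : G ≅ H) → Emb G H (isoTo σ)
isoEmb' G H σ = toInj (proj₁ σ) , λ i j → sym (proj₂ σ i j)

-- if T' is obtainable, then so is the result of any operation applied to
-- T' with respect to the EOD set D and ECD set P (for O₄, O₅ stated via
-- neighbourhoods instead of degrees)
module ObtOps {m} (T' : Graph m) (ob : Obtainable T') (D P : Fin m → Bool) (eD : IsEOD T' D) (eP : IsECD T' P) where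
  k = proj₁ ob
  G = proj₁ (proj₂ ob)
  g = proj₁ (proj₂ (proj₂ ob))
  σ = proj₂ (proj₂ (proj₂ ob))
  fr = isoFrom σ
  tf : ∀ y → isoTo σ (fr y) ≡ y
  tf = toFrom (proj₁ σ)
  DG = D ∘ isoTo σ
  PG = P ∘ isoTo σ
  eDG = EOD-transport G T' σ D eD
  ePG = ECD-transport G T' σ P eP
  lab : ∀ (S : Fin m → Bool) {a b} → S a ≡ b → S (isoTo σ (fr a)) ≡ b
  lab S {a} e = trans (cong S (tf a)) e
  module E = EmbL G T' (isoTo σ) (isoEmb' G T' σ)
  τ : T' ≅ G
  τ = isoSym {G = G} {T'} σ
  frAdj : ∀ {a b} → Adj T' a b → Adj G (fr a) (fr b)
  frAdj = isoAdj T' G τ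

  obtO1 : ∀ u → D u ≡ true → P u ≡ true → Obtainable (addLeaf T' u)
  obtO1 u du pu = suc k , addLeaf G (fr u) , O1 g DG PG eDG ePG (fr u) (lab D du) (lab P pu) ,
    liftLeaf {G = G} {T'} σ (tf u)

  obtO2 : ∀ w → D w ≡ false → Obtainable (addPendantPath 2 T' w)
  obtO2 w dw = _ , addPendantPath 2 G (fr w) , O2 g DG PG eDG ePG (fr w) (lab D dw) , liftPath G T' σ (tf w) 2

  obtO3 : ∀ t → D t ≡ true → P t ≡ false → Obtainable (addPendantPath 4 T' t)
  obtO3 t dt pt = _ , addPendantPath 4 G (fr t) , O3 g DG PG eDG ePG (fr t) (lab D dt) (lab P pt) , liftPath G T' σ (tf t) 4

  obtO4 : ∀ v u x → OnlyNeighbour T' v u → TwoNeighbours T' u v x → D u ≡ true → D x ≡ true → P u ≡ true → Obtainable (addLeaf T' x)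
  obtO4 v u x ov tu du dx pu =
    suc k , addLeaf G (fr x) ,
    O4 g DG PG eDG ePG (fr v) (fr u) (fr x) (λ e → adjIrr G (proj₁ ovG) e) (λ e → v≢x (fromInj (proj₁ σ) e))
      (λ e → adjIrr G (proj₁ (proj₂ (proj₂ tuG))) e)
      (proj₁ ovG) (proj₁ (proj₂ (proj₂ tuG)))
      (deg1⇐ G (fr v) (fr u) ovG) (deg2⇐ G (fr u) (fr v) (fr x) tuG) (lab D du) (lab D dx) (lab P pu) ,
    liftLeaf {G = G} {T'} σ (tf x)
    where
    ovG : OnlyNeighbour G (fr v) (fr u)
    ovG = E.oneE (tf v) (tf u) ov
    tuG : TwoNeighbours G (fr u) (fr v) (fr x)
    tuG = E.twoE (tf u) (tf v) (tf x) tu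
    v≢x : v ≢ x
    v≢x = proj₁ tu

  obtO5 : ∀ u x w z w' x' → Unique (u ∷ x ∷ w ∷ z ∷ w' ∷ x' ∷ []) → Linked.Linked (Adj T') (u ∷ x ∷ w ∷ z ∷ w' ∷ x' ∷ []) →
          OnlyNeighbour T' u x → OnlyNeighbour T' x' w' → TwoNeighbours T' x u w → TwoNeighbours T' w x z → TwoNeighbours T' w' z x' →
          D u ≡ true → D x ≡ true → D w' ≡ true → D x' ≡ true → P x ≡ true → P w' ≡ true →
          Obtainable (addLeaf T' u)
  obtO5 u x w z w' x' uq lk ou ox' tx tw tw' du dx dw' dx' px pw' =
    suc k , addLeaf G (fr u) ,
    O5 g DG PG eDG ePG (fr u) (fr x) (fr w) (fr z) (fr w') (fr x')
      (UniqueP.map⁺ (fromInj (proj₁ σ)) uq)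
      (LinkedP.map⁺ (Linked.map frAdj lk))
      (deg1⇐ G _ _ (E.oneE (tf u) (tf x) ou)) (deg1⇐ G _ _ (E.oneE (tf x') (tf w') ox'))
      (deg2⇐ G _ _ _ (E.twoE (tf x) (tf u) (tf w) tx)) (deg2⇐ G _ _ _ (E.twoE (tf w) (tf x) (tf z) tw))
      (deg2⇐ G _ _ _ (E.twoE (tf w') (tf z) (tf x') tw'))
      (lab D du) (lab D dx) (lab D dw') (lab D dx') (lab P px) (lab P pw') ,
    liftLeaf {G = G} {T'} σ (tf u)

-- Peeling a sequence of leaves a₁, a₂, … (each a
-- leaf of what remains) leaves an induced subtree of T on the remaining
-- vertices ('Remainder'); T is recovered from it by adding the peeled
-- vertices back as leaves, i.e. as a pendant path ('glue').

glue : ∀ {k m n} (X : Graph k) (T1 : Graph m) (T : Graph n) (y : Fin k) (u1 : Fin m) →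
       (τ : X ≅ T1) → isoTo τ y ≡ u1 → addLeaf T1 u1 ≅ T → addLeaf X y ≅ T
glue X T1 T y u1 τ e σ = isoTrans {G = addLeaf X y} {addLeaf T1 u1} {T} (liftLeaf {G = X} {T1} τ e) σ

twoToOne : ∀ {m n} (T1 : Graph m) (T : Graph n) ι → Emb T1 T ι → ∀ {a b c a' b'} → ι a' ≡ a → ι b' ≡ b →
           TwoNeighbours T a b c → (∀ y → ι y ≢ c) → OnlyNeighbour T1 a' b'
twoToOne T1 T ι emb refl refl (_ , ab , ac , q) out = E.adjE ab , λ y ay → aux y (q (ι y) (E.adjE⁻ ay))
  where
  module E = EmbL T1 T ι emb
  aux : ∀ y → ι y ≡ _ ⊎ ι y ≡ _ → y ≡ _
  aux y (inj₁ e) = E.inj e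
  aux y (inj₂ e) = ⊥-elim (out y e)

module Chain {n} (T : Graph n) (tr : IsTree T) where

  record Remainder (R : List (Fin n)) : Set where
    field
      m : ℕ
      len : n ≡ m + length R
      Tm : Graph m
      ι : Fin m → Fin n
      emb : Emb Tm T ι
      out : ∀ y → All (λ r → ι y ≢ r) R
      surj : ∀ y → All (λ r → y ≢ r) R → Σ (Fin m) λ y' → ι y' ≡ y
      trm : IsTree Tm

  nothingRemoved : Remainder []
  nothingRemoved = record { m = n ; len = sym (+-identityʳ n) ; Tm = T ; ι = id ; emb = (λ e → e) , (λ _ _ → refl)
               ; out = λ _ → [] ; surj = λ y _ → y , refl ; trm = tr }

  record PeelStep {R} (S : Remainder R) (a b : Fin n) (ak : Fin (Remainder.m S)) : Set where
    field
      S' : Remainder (a ∷ R)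
      b' : Fin (Remainder.m S')
      ιb : Remainder.ι S' b' ≡ b
      τ : addLeaf (Remainder.Tm S') b' ≅ Remainder.Tm S
      τ0 : isoTo τ zero ≡ ak

  abstract
    peelStep : ∀ {R} (S : Remainder R) a b ak bk → Remainder.ι S ak ≡ a → Remainder.ι S bk ≡ b → OnlyNeighbour (Remainder.Tm S) ak bk → PeelStep S a b ak
    peelStep {R} S a b ak bk ea eb o = record { S' = S' ; b' = Peeled.u1 pl ; ιb = ιb ; τ = Peeled.σ pl ; τ0 = Peeled.σ0 pl }
      where
      open Remainder S
      pl : Peeled Tm ak bk
      pl = peel Tm ak bk o
      module pl = Peeled pl
      module E = EmbL Tm T ι emb
      S' : Remainder (a ∷ R)
      S' = record
        { m = pl.m
        ; len = trans len (trans (cong (_+ length R) pl.eq) (sym (+-suc pl.m (length R))))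
        ; Tm = pl.T1
        ; ι = ι ∘ pl.ι
        ; emb = embComp pl.T1 Tm T pl.ι ι pl.emb emb
        ; out = λ y → (λ e → pl.ιne y (E.inj (trans e (sym ea)))) ∷ out (pl.ι y)
        ; surj = λ { y (y≢a ∷ rest) → sj y y≢a rest }
        ; trm = pl.tree1 trm
        }
        where
        sj : ∀ y → y ≢ a → All (λ r → y ≢ r) R → Σ (Fin pl.m) λ y' → ι (pl.ι y') ≡ y
        sj y y≢a rest with surj y rest
        ... | y1 , e1 with pl.surj y1 (λ e → y≢a (trans (sym e1) (trans (cong ι e) ea)))
        ... | y2 , e2 = y2 , trans (cong ι e2) e1
      ιb : ι (pl.ι pl.u1) ≡ b
      ιb = trans (cong ι pl.σu) eb

  lenLt : ∀ {R} (S : Remainder R) → 1 ≤ length R → Remainder.m S < n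
  lenLt {R} S p = subst (Remainder.m S <_) (sym (Remainder.len S)) (m<m+n (Remainder.m S) p)

-- In each configuration a pendant path is peeled, the
-- labels restricted (D stays an EOD set when no removed vertex dominates a
-- remaining one, and similarly for P), and T is recovered by an operation.

Smaller⇒Obtainable : ℕ → Set
Smaller⇒Obtainable n = ∀ {m} → m < n → (T' : Graph m) → IsTree T' → IsEOCD T' → Obtainable T'


nbRem3 : ∀ {n} (T : Graph n) {x u v s c} → (∀ y → Adj T u y → y ≡ x ⊎ y ≡ v) → (∀ y → Adj T v y → y ≡ u) →
         All (λ r → s ≢ r) (x ∷ u ∷ v ∷ []) → Adj T c s → All (λ r → c ≢ r) (x ∷ u ∷ v ∷ []) ⊎ c ≡ x
nbRem3 T {x} {u} {v} {s} {c} qu qv (ox ∷ ou ∷ ov' ∷ []) a with c ≟ x | c ≟ u | c ≟ v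
... | yes e | _ | _ = inj₂ e
... | no _ | yes refl | _ = ⊥-elim ([ ox , ov' ]′ (qu s a))
... | no _ | no _ | yes refl = ⊥-elim (ou (qv s a))
... | no c≢x | no c≢u | no c≢v = inj₁ (c≢x ∷ c≢u ∷ c≢v ∷ [])

nbRem5 : ∀ {n} (T : Graph n) {z w x u v s c} → (∀ y → Adj T w y → y ≡ z ⊎ y ≡ x) → (∀ y → Adj T x y → y ≡ w ⊎ y ≡ u) →
         (∀ y → Adj T u y → y ≡ x ⊎ y ≡ v) → (∀ y → Adj T v y → y ≡ u) →
         All (λ r → s ≢ r) (z ∷ w ∷ x ∷ u ∷ v ∷ []) → Adj T c s → All (λ r → c ≢ r) (z ∷ w ∷ x ∷ u ∷ v ∷ []) ⊎ c ≡ z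
nbRem5 T {z} {w} {x} {u} {v} {s} {c} qw qx qu qv (oz ∷ ow ∷ ox ∷ ou ∷ ov' ∷ []) a with c ≟ z | c ≟ w | c ≟ x | c ≟ u | c ≟ v
... | yes e | _ | _ | _ | _ = inj₂ e
... | no _ | yes refl | _ | _ | _ = ⊥-elim ([ oz , ox ]′ (qw s a))
... | no _ | no _ | yes refl | _ | _ = ⊥-elim ([ ow , ou ]′ (qx s a))
... | no _ | no _ | no _ | yes refl | _ = ⊥-elim ([ ox , ov' ]′ (qu s a))
... | no _ | no _ | no _ | no _ | yes refl = ⊥-elim (ou (qv s a))
... | no a1 | no a2 | no a3 | no a4 | no a5 = inj₁ (a1 ∷ a2 ∷ a3 ∷ a4 ∷ a5 ∷ [])

remAll : ∀ {n} {R : List (Fin n)} {c z} (S : Fin n → Bool) → S c ≡ true → S z ≡ false →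
         All (λ r → c ≢ r) R ⊎ c ≡ z → All (λ r → c ≢ r) R
remAll S sc sz (inj₁ h) = h
remAll S sc sz (inj₂ refl) = ⊥-elim (clash sc sz)

module Red {n} (T : Graph n) (tr : IsTree T) (D P : Fin n → Bool) (eD : IsEOD T D) (eP : IsECD T P) (IH : Smaller⇒Obtainable n) where
  open Chain T tr

  domOf : ∀ ℓ c → OnlyNeighbour T ℓ c → D c ≡ true
  domOf ℓ c (_ , q) with eD ℓ
  ... | v , (dv , a) , _ = subst (λ t → D t ≡ true) (q v (adjSym T a)) dv

  restrD : ∀ {R} (S : Remainder R) → (∀ s v → Dom T D (Remainder.ι S s) v → All (λ r → v ≢ r) R) → IsEOD (Remainder.Tm S) (D ∘ Remainder.ι S)
  restrD S h = EmbL.restrictD (Remainder.Tm S) T (Remainder.ι S) (Remainder.emb S) D (λ s → eD (Remainder.ι S s)) (λ s v d → Remainder.surj S v (h s v d))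

  restrP : ∀ {R} (S : Remainder R) P1 → (∀ s → ∃! _≡_ (Cov T P1 (Remainder.ι S s))) →
           (∀ s v → Cov T P1 (Remainder.ι S s) v → All (λ r → v ≢ r) R) → IsECD (Remainder.Tm S) (P1 ∘ Remainder.ι S)
  restrP S P1 ex h = EmbL.restrictP (Remainder.Tm S) T (Remainder.ι S) (Remainder.emb S) P1 ex (λ s v d → Remainder.surj S v (h s v d))

  survAll : ∀ {R} (S : Remainder R) s v → v ≡ Remainder.ι S s → All (λ r → v ≢ r) R
  survAll S s v refl = Remainder.out S s

  obtEnd : ∀ {R} (S : Remainder R) → 1 ≤ length R → ∀ D' P' → IsEOD (Remainder.Tm S) D' → IsECD (Remainder.Tm S) P' → Obtainable (Remainder.Tm S)
  obtEnd S p D' P' e1 e2 = IH (lenLt S p) (Remainder.Tm S) (Remainder.trm S) ((D' , e1) , (P' , e2))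

  -- O₁: a leaf ℓ ∉ D at c ∈ P; c dominates ℓ, and removing ℓ keeps D and P
  reduceO1 : ∀ ℓ c → OnlyNeighbour T ℓ c → D ℓ ≡ false → P c ≡ true → Obtainable T
  reduceO1 ℓ c ol dℓ pc = obtainable-transport (addLeaf T1 (PeelStep.b' st)) T ob2 (PeelStep.τ st)
    where
    st = peelStep nothingRemoved ℓ c ℓ c refl refl ol
    S1 = PeelStep.S' st
    T1 = Remainder.Tm S1
    ι1 = Remainder.ι S1
    pℓ : P ℓ ≡ false
    pℓ = ecdNeighbourOut T P eP pc (adjSym T (proj₁ ol))
    eD' = restrD S1 λ s v (dv , _) → (λ e → clash dv (trans (cong D e) dℓ)) ∷ []
    eP' = restrP S1 P (λ s → eP (ι1 s)) λ s v (pv , _) → (λ e → clash pv (trans (cong P e) pℓ)) ∷ []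
    ob1 = obtEnd S1 (s≤s z≤n) _ _ eD' eP'
    ob2 = ObtOps.obtO1 T1 ob1 (D ∘ ι1) (P ∘ ι1) eD' eP' (PeelStep.b' st)
            (trans (cong D (PeelStep.ιb st)) (domOf ℓ c ol)) (trans (cong P (PeelStep.ιb st)) pc)

  reduceO2 : ∀ w x u v → TwoNeighbours T x w u → TwoNeighbours T u x v → OnlyNeighbour T v u → D w ≡ false → D x ≡ false → P x ≡ false → Obtainable T
  reduceO2 w x u v tx tu ov dw dx px =
    obtainable-transport (addPendantPath 2 T3 w3) T ob2 iso
    where
    qv = proj₂ ov
    qu = proj₂ (proj₂ (proj₂ tu))
    st1 = peelStep nothingRemoved v u v u refl refl ov
    S1 = PeelStep.S' st1
    x1 = Remainder.surj S1 x (proj₁ tu ∷ [])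
    o1 : OnlyNeighbour (Remainder.Tm S1) (PeelStep.b' st1) (proj₁ x1)
    o1 = twoToOne (Remainder.Tm S1) T (Remainder.ι S1) (Remainder.emb S1) (PeelStep.ιb st1) (proj₂ x1) tu (λ y → All.head (Remainder.out S1 y))
    st2 = peelStep S1 u x (PeelStep.b' st1) (proj₁ x1) (PeelStep.ιb st1) (proj₂ x1) o1
    S2 = PeelStep.S' st2
    w≢v : w ≢ v
    w≢v e = adjIrr T (proj₁ (proj₂ (proj₂ tx))) (qv x (adjSym T (subst (Adj T x) e (proj₁ (proj₂ tx)))))
    w2 = Remainder.surj S2 w (proj₁ tx ∷ w≢v ∷ [])
    o2 : OnlyNeighbour (Remainder.Tm S2) (PeelStep.b' st2) (proj₁ w2)
    o2 = twoToOne (Remainder.Tm S2) T (Remainder.ι S2) (Remainder.emb S2) (PeelStep.ιb st2) (proj₂ w2) tx (λ y → All.head (Remainder.out S2 y))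
    st3 = peelStep S2 x w (PeelStep.b' st2) (proj₁ w2) (PeelStep.ιb st2) (proj₂ w2) o2
    S3 = PeelStep.S' st3
    T3 = Remainder.Tm S3
    ι3 = Remainder.ι S3
    w3 = PeelStep.b' st3
    eD' = restrD S3 λ s c (dc , a) → remAll D dc dx (nbRem3 T qu qv (Remainder.out S3 s) a)
    eP' = restrP S3 P (λ s → eP (ι3 s)) λ { s c (pc , inj₁ e) → survAll S3 s c e
                                          ; s c (pc , inj₂ a) → remAll P pc px (nbRem3 T qu qv (Remainder.out S3 s) a) }
    ob1 = obtEnd S3 (s≤s z≤n) _ _ eD' eP'
    ob2 = ObtOps.obtO2 T3 ob1 (D ∘ ι3) (P ∘ ι3) eD' eP' w3 (trans (cong D (PeelStep.ιb st3)) dw)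
    X1 = addLeaf (addLeaf T3 w3) zero
    i1 : X1 ≅ Remainder.Tm S1
    i1 = glue (addLeaf T3 w3) (Remainder.Tm S2) (Remainder.Tm S1) zero (PeelStep.b' st2) (PeelStep.τ st3) (PeelStep.τ0 st3) (PeelStep.τ st2)
    iso : addPendantPath 2 T3 w3 ≅ T
    iso = glue X1 (Remainder.Tm S1) T zero (PeelStep.b' st1) i1 (PeelStep.τ0 st2) (PeelStep.τ st1)

  reduceO3 : ∀ t z w x u v → TwoNeighbours T z t w → TwoNeighbours T w z x → TwoNeighbours T x w u → TwoNeighbours T u x v → OnlyNeighbour T v u →
          D t ≡ true → P t ≡ false → D z ≡ false → P z ≡ false → Obtainable T
  reduceO3 t z w x u v tz tw tx tu ov dt pt dz pz =
    obtainable-transport (addPendantPath 4 T5 t5) T ob2 iso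
    where
    qv = proj₂ ov
    qu = proj₂ (proj₂ (proj₂ tu))
    qx = proj₂ (proj₂ (proj₂ tx))
    qw = proj₂ (proj₂ (proj₂ tw))
    axw = proj₁ (proj₂ tx)
    axu = proj₁ (proj₂ (proj₂ tx))
    awz = proj₁ (proj₂ tw)
    awx = proj₁ (proj₂ (proj₂ tw))
    azt = proj₁ (proj₂ tz)
    azw = proj₁ (proj₂ (proj₂ tz))
    st1 = peelStep nothingRemoved v u v u refl refl ov
    S1 = PeelStep.S' st1
    x1 = Remainder.surj S1 x (proj₁ tu ∷ [])
    o1 = twoToOne (Remainder.Tm S1) T (Remainder.ι S1) (Remainder.emb S1) (PeelStep.ιb st1) (proj₂ x1) tu (λ y → All.head (Remainder.out S1 y))
    st2 = peelStep S1 u x (PeelStep.b' st1) (proj₁ x1) (PeelStep.ιb st1) (proj₂ x1) o1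
    S2 = PeelStep.S' st2
    w≢v : w ≢ v
    w≢v e = adjIrr T axu (qv x (adjSym T (subst (Adj T x) e axw)))
    w2 = Remainder.surj S2 w (proj₁ tx ∷ w≢v ∷ [])
    o2 = twoToOne (Remainder.Tm S2) T (Remainder.ι S2) (Remainder.emb S2) (PeelStep.ιb st2) (proj₂ w2) tx (λ y → All.head (Remainder.out S2 y))
    st3 = peelStep S2 x w (PeelStep.b' st2) (proj₁ w2) (PeelStep.ιb st2) (proj₂ w2) o2
    S3 = PeelStep.S' st3
    z≢u : z ≢ u
    z≢u e = [ adjIrr T awx , w≢v ]′ (qu w (adjSym T (subst (Adj T w) e awz)))
    z≢v : z ≢ v
    z≢v e = proj₁ tx (qv w (adjSym T (subst (Adj T w) e awz)))
    z3 = Remainder.surj S3 z (proj₁ tw ∷ z≢u ∷ z≢v ∷ [])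
    o3 = twoToOne (Remainder.Tm S3) T (Remainder.ι S3) (Remainder.emb S3) (PeelStep.ιb st3) (proj₂ z3) tw (λ y → All.head (Remainder.out S3 y))
    st4 = peelStep S3 w z (PeelStep.b' st3) (proj₁ z3) (PeelStep.ιb st3) (proj₂ z3) o3
    S4 = PeelStep.S' st4
    t≢x : t ≢ x
    t≢x e = [ adjIrr T azw , z≢u ]′ (qx z (adjSym T (subst (Adj T z) e azt)))
    t≢u : t ≢ u
    t≢u e = [ proj₁ tw , z≢v ]′ (qu z (adjSym T (subst (Adj T z) e azt)))
    t≢v : t ≢ v
    t≢v e = z≢u (qv z (adjSym T (subst (Adj T z) e azt)))
    t4 = Remainder.surj S4 t (proj₁ tz ∷ t≢x ∷ t≢u ∷ t≢v ∷ [])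
    o4 = twoToOne (Remainder.Tm S4) T (Remainder.ι S4) (Remainder.emb S4) (PeelStep.ιb st4) (proj₂ t4) tz (λ y → All.head (Remainder.out S4 y))
    st5 = peelStep S4 z t (PeelStep.b' st4) (proj₁ t4) (PeelStep.ιb st4) (proj₂ t4) o4
    S5 = PeelStep.S' st5
    T5 = Remainder.Tm S5
    ι5 = Remainder.ι S5
    t5 = PeelStep.b' st5
    eD' = restrD S5 λ s c (dc , a) → remAll D dc dz (nbRem5 T qw qx qu qv (Remainder.out S5 s) a)
    eP' = restrP S5 P (λ s → eP (ι5 s)) λ { s c (pc , inj₁ e) → survAll S5 s c e
                                          ; s c (pc , inj₂ a) → remAll P pc pz (nbRem5 T qw qx qu qv (Remainder.out S5 s) a) }
    ob1 = obtEnd S5 (s≤s z≤n) _ _ eD' eP'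
    ob2 = ObtOps.obtO3 T5 ob1 (D ∘ ι5) (P ∘ ι5) eD' eP' t5 (trans (cong D (PeelStep.ιb st5)) dt) (trans (cong P (PeelStep.ιb st5)) pt)
    X0 = addLeaf T5 t5
    X1 = addLeaf X0 zero
    X2 = addLeaf X1 zero
    X3 = addLeaf X2 zero
    i1 : X1 ≅ Remainder.Tm S3
    i1 = glue X0 (Remainder.Tm S4) (Remainder.Tm S3) zero (PeelStep.b' st4) (PeelStep.τ st5) (PeelStep.τ0 st5) (PeelStep.τ st4)
    i2 : X2 ≅ Remainder.Tm S2
    i2 = glue X1 (Remainder.Tm S3) (Remainder.Tm S2) zero (PeelStep.b' st3) i1 (PeelStep.τ0 st4) (PeelStep.τ st3)
    i3 : X3 ≅ Remainder.Tm S1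
    i3 = glue X2 (Remainder.Tm S2) (Remainder.Tm S1) zero (PeelStep.b' st2) i2 (PeelStep.τ0 st3) (PeelStep.τ st2)
    iso : addPendantPath 4 T5 t5 ≅ T
    iso = glue X3 (Remainder.Tm S1) T zero (PeelStep.b' st1) i3 (PeelStep.τ0 st2) (PeelStep.τ st1)

  -- O₄: a leaf y ∈ P at x, and a path v u x with v ∈ P a leaf and
  -- deg u = 2, u, x ∈ D; after removing y, P is shifted from v to u
  reduceO4 : ∀ y x u v → OnlyNeighbour T y x → TwoNeighbours T u v x → OnlyNeighbour T v u → D u ≡ true → D x ≡ true → P v ≡ true → P y ≡ true → Obtainable T
  reduceO4 y x u v oy tu ov du dx pv py =
    obtainable-transport (addLeaf T1 x1) T ob2 (PeelStep.τ st)
    where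
    ayx = proj₁ oy
    qy = proj₂ oy
    v≢x = proj₁ tu
    auv = proj₁ (proj₂ tu)
    aux = proj₁ (proj₂ (proj₂ tu))
    avu = proj₁ ov
    u≢x = adjIrr T aux
    y≢u : y ≢ u
    y≢u e = v≢x (trans (qy v (subst (λ t → Adj T t v) (sym e) auv)) (sym (qy x (subst (λ t → Adj T t x) (sym e) aux))))
    y≢v : y ≢ v
    y≢v e = u≢x (qy u (subst (λ t → Adj T t u) (sym e) avu))
    dy : D y ≡ false
    dy = ¬true⇒false λ d → y≢u (domUniq T D eD (d , ayx) (du , aux))
    px : P x ≡ false
    px = ecdNeighbourOut T P eP py ayx
    Pa = upd P v false
    Pb = upd Pa y false
    P1 = upd Pb u true
    p1u : P1 u ≡ true
    p1u = upd-eq Pb u true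
    p1v : P1 v ≡ false
    p1v = trans (upd-ne Pb u true v (adjIrr T avu)) (trans (upd-ne Pa y false v (≢-sym y≢v)) (upd-eq P v false))
    p1y : P1 y ≡ false
    p1y = trans (upd-ne Pb u true y y≢u) (upd-eq Pa y false)
    p1o : ∀ i → i ≢ u → i ≢ v → i ≢ y → P1 i ≡ P i
    p1o i a b c = trans (upd-ne Pb u true i a) (trans (upd-ne Pa y false i c) (upd-ne P v false i b))
    p1x : P1 x ≡ false
    p1x = trans (p1o x (≢-sym u≢x) (≢-sym v≢x) (≢-sym (adjIrr T ayx))) px
    st = peelStep nothingRemoved y x y x refl refl oy
    S1 = PeelStep.S' st
    T1 = Remainder.Tm S1
    ι1 = Remainder.ι S1
    x1 = PeelStep.b' st
    eD' = restrD S1 λ s c (dc , _) → (λ e → clash dc (trans (cong D e) dy)) ∷ []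
    eP' = restrP S1 P1 (λ s → ecdBeforeO4 T P eP P1 y x u v oy tu ov py p1u p1v p1y p1x p1o (ι1 s) (All.head (Remainder.out S1 s)))
            λ s c (pc , _) → (λ e → clash pc (trans (cong P1 e) p1y)) ∷ []
    ob1 = obtEnd S1 (s≤s z≤n) _ _ eD' eP'
    v1 = Remainder.surj S1 v (≢-sym y≢v ∷ [])
    u1 = Remainder.surj S1 u (≢-sym y≢u ∷ [])
    module EE = EmbL T1 T ι1 (Remainder.emb S1)
    ob2 = ObtOps.obtO4 T1 ob1 (D ∘ ι1) (P1 ∘ ι1) eD' eP' (proj₁ v1) (proj₁ u1) x1
            (EE.oneE (proj₂ v1) (proj₂ u1) ov) (EE.twoE (proj₂ u1) (proj₂ v1) (PeelStep.ιb st) tu)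
            (trans (cong D (proj₂ u1)) du) (trans (cong D (PeelStep.ιb st)) dx) (trans (cong P1 (proj₂ u1)) p1u)

  -- O₅: a leaf v at u and a path u x w z w' x' of degree-two vertices
  -- ending in the leaf x', with the labels forced by the removal of v;
  -- after removing v, P is shifted from w, x' to x, w'
  reduceO5 : ∀ v u x w z w' x' → OnlyNeighbour T v u → TwoNeighbours T u x v → TwoNeighbours T x w u → TwoNeighbours T w z x →
          TwoNeighbours T w' z x' → OnlyNeighbour T x' w' →
          P v ≡ true → D v ≡ false → D u ≡ true → D x ≡ true → P w ≡ true → D w ≡ false →
          D z ≡ false → P z ≡ false → D w' ≡ true → D x' ≡ true → P x' ≡ true → Obtainable T
  reduceO5 v u x w z w' x' ov tu tx tw tw' ox' pv dv du dx pw dw dz pz dw' dx' px' =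
    obtainable-transport (addLeaf T1 u1) T ob2 (PeelStep.τ st)
    where
    avu = proj₁ ov
    qv = proj₂ ov
    aux = proj₁ (proj₂ tu)
    qu = proj₂ (proj₂ (proj₂ tu))
    axw = proj₁ (proj₂ tx)
    awz = proj₁ (proj₂ tw)
    awx = proj₁ (proj₂ (proj₂ tw))
    qw = proj₂ (proj₂ (proj₂ tw))
    aw'z = proj₁ (proj₂ tw')
    aw'x' = proj₁ (proj₂ (proj₂ tw'))
    qw' = proj₂ (proj₂ (proj₂ tw'))
    ax'w' = proj₁ ox'
    pu : P u ≡ false
    pu = ecdNeighbourOut T P eP pv avu
    px : P x ≡ false
    px = ecdNeighbourOut T P eP pw awx
    v≢u = adjIrr T avu
    v≢x = ≢-sym (labelsDiffer D dx dv)
    v≢z = labelsDiffer P pv pz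
    v≢w' = ≢-sym (labelsDiffer D dw' dv)
    v≢x' = ≢-sym (labelsDiffer D dx' dv)
    v≢w : v ≢ w
    v≢w e = [ labelsDiffer D du dz , adjIrr T aux ]′ (qw u (adjSym T (subst (Adj T u) e (adjSym T avu))))
    u≢x = adjIrr T aux
    u≢w = labelsDiffer D du dw
    u≢z = labelsDiffer D du dz
    u≢x' = ≢-sym (labelsDiffer P px' pu)
    u≢w' : u ≢ w'
    u≢w' e = [ v≢z , v≢x' ]′ (qw' v (subst (λ t → Adj T t v) e (adjSym T avu)))
    x≢w = labelsDiffer D dx dw
    x≢z = labelsDiffer D dx dz
    x≢x' = ≢-sym (labelsDiffer P px' px)
    x≢w' : x ≢ w'
    x≢w' e = [ labelsDiffer P pw pz , (λ q → labelsDiffer D dx' dw (sym q)) ]′ (qw' w (subst (λ t → Adj T t w) e axw))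
    w≢z = adjIrr T awz
    w≢w' = ≢-sym (labelsDiffer D dw' dw)
    w≢x' = ≢-sym (labelsDiffer D dx' dw)
    z≢w' = ≢-sym (labelsDiffer D dw' dz)
    z≢x' = ≢-sym (labelsDiffer D dx' dz)
    w'≢x' = adjIrr T aw'x'
    Pa = upd P v false
    Pb = upd Pa w false
    Pc = upd Pb x' false
    Pd = upd Pc x true
    P1 = upd Pd w' true
    p1w' : P1 w' ≡ true
    p1w' = upd-eq Pd w' true
    p1x : P1 x ≡ true
    p1x = trans (upd-ne Pd w' true x x≢w') (upd-eq Pc x true)
    p1x' : P1 x' ≡ false
    p1x' = trans (upd-ne Pd w' true x' (≢-sym w'≢x')) (trans (upd-ne Pc x true x' (≢-sym x≢x')) (upd-eq Pb x' false))
    p1w : P1 w ≡ false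
    p1w = trans (upd-ne Pd w' true w w≢w') (trans (upd-ne Pc x true w (≢-sym x≢w)) (trans (upd-ne Pb x' false w w≢x') (upd-eq Pa w false)))
    p1v : P1 v ≡ false
    p1v = trans (upd-ne Pd w' true v v≢w') (trans (upd-ne Pc x true v v≢x) (trans (upd-ne Pb x' false v v≢x')
            (trans (upd-ne Pa w false v v≢w) (upd-eq P v false))))
    p1o : ∀ i → i ≢ v → i ≢ w → i ≢ x' → i ≢ x → i ≢ w' → P1 i ≡ P i
    p1o i a b c d e = trans (upd-ne Pd w' true i e) (trans (upd-ne Pc x true i d) (trans (upd-ne Pb x' false i c)
            (trans (upd-ne Pa w false i b) (upd-ne P v false i a))))
    p1u : P1 u ≡ false
    p1u = trans (p1o u (≢-sym v≢u) u≢w u≢x' u≢x u≢w') pu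
    p1z : P1 z ≡ false
    p1z = trans (p1o z (≢-sym v≢z) (≢-sym w≢z) z≢x' (≢-sym x≢z) z≢w') pz
    st = peelStep nothingRemoved v u v u refl refl ov
    S1 = PeelStep.S' st
    T1 = Remainder.Tm S1
    ι1 = Remainder.ι S1
    u1 = PeelStep.b' st
    eD' = restrD S1 λ s c (dc , _) → (λ e → clash dc (trans (cong D e) dv)) ∷ []
    eP' = restrP S1 P1 (λ s → ecdBeforeO5 T P eP P1 v u x w z w' x' ov tu tx tw tw' ox' pw u≢z x≢z w≢z v≢z z≢w'
                                 p1x p1w' p1u p1v p1w p1z p1x' p1o (ι1 s) (All.head (Remainder.out S1 s)))
            λ s c (pc , _) → (λ e → clash pc (trans (cong P1 e) p1v)) ∷ []
    ob1 = obtEnd S1 (s≤s z≤n) _ _ eD' eP'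
    module EE = EmbL T1 T ι1 (Remainder.emb S1)
    X = Remainder.surj S1 x (≢-sym v≢x ∷ [])
    W = Remainder.surj S1 w (≢-sym v≢w ∷ [])
    Z = Remainder.surj S1 z (≢-sym v≢z ∷ [])
    W' = Remainder.surj S1 w' (≢-sym v≢w' ∷ [])
    X' = Remainder.surj S1 x' (≢-sym v≢x' ∷ [])
    ιu = PeelStep.ιb st
    dq : ∀ {a b a' b'} → ι1 a' ≡ a → ι1 b' ≡ b → a ≢ b → a' ≢ b'
    dq ea eb q e = q (trans (sym ea) (trans (cong ι1 e) eb))
    uqL = (dq ιu (proj₂ X) u≢x ∷ dq ιu (proj₂ W) u≢w ∷ dq ιu (proj₂ Z) u≢z ∷ dq ιu (proj₂ W') u≢w' ∷ dq ιu (proj₂ X') u≢x' ∷ []) ∷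
          (dq (proj₂ X) (proj₂ W) x≢w ∷ dq (proj₂ X) (proj₂ Z) x≢z ∷ dq (proj₂ X) (proj₂ W') x≢w' ∷ dq (proj₂ X) (proj₂ X') x≢x' ∷ []) ∷
          (dq (proj₂ W) (proj₂ Z) w≢z ∷ dq (proj₂ W) (proj₂ W') w≢w' ∷ dq (proj₂ W) (proj₂ X') w≢x' ∷ []) ∷
          (dq (proj₂ Z) (proj₂ W') z≢w' ∷ dq (proj₂ Z) (proj₂ X') z≢x' ∷ []) ∷
          (dq (proj₂ W') (proj₂ X') w'≢x' ∷ []) ∷ [] ∷ []
    lkL = EE.adjE' ιu (proj₂ X) aux ∷ EE.adjE' (proj₂ X) (proj₂ W) axw ∷ EE.adjE' (proj₂ W) (proj₂ Z) awz ∷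
          EE.adjE' (proj₂ Z) (proj₂ W') (adjSym T aw'z) ∷ EE.adjE' (proj₂ W') (proj₂ X') aw'x' ∷ [-]
    ob2 = ObtOps.obtO5 T1 ob1 (D ∘ ι1) (P1 ∘ ι1) eD' eP' u1 (proj₁ X) (proj₁ W) (proj₁ Z) (proj₁ W') (proj₁ X') uqL lkL
            (twoToOne T1 T ι1 (Remainder.emb S1) ιu (proj₂ X) tu (λ y → All.head (Remainder.out S1 y)))
            (EE.oneE (proj₂ X') (proj₂ W') ox')
            (EE.twoE (proj₂ X) ιu (proj₂ W) (twoSwap T tx))
            (EE.twoE (proj₂ W) (proj₂ X) (proj₂ Z) (twoSwap T tw))
            (EE.twoE (proj₂ W') (proj₂ Z) (proj₂ X') tw')
            (trans (cong D ιu) du) (trans (cong D (proj₂ X)) dx) (trans (cong D (proj₂ W')) dw') (trans (cong D (proj₂ X')) dx')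
            (trans (cong P1 (proj₂ X)) p1x) (trans (cong P1 (proj₂ W')) p1w')

-- Finite exploration.  Paths in T are duplicate-free lists of vertices,
-- hence have at most n entries (pigeonhole); this bounds the recursion
-- that explores T from a leaf.

allLookup : ∀ {A : Set} {P : A → Set} {xs : List A} → All P xs → ∀ j → P (lookup xs j)
allLookup (p ∷ _) zero = p
allLookup (_ ∷ ps) (suc j) = allLookup ps j

uqLookup : ∀ {n} {xs : List (Fin n)} → Unique xs → ∀ {i j} → Fin._<_ i j → lookup xs i ≢ lookup xs j
uqLookup (px ∷ _) {zero} {suc j} _ = allLookup px j
uqLookup (_ ∷ rest) {suc i} {suc j} (s≤s i<j) = uqLookup rest i<j

uniqLen : ∀ {n} (xs : List (Fin n)) → Unique xs → ¬ (n < length xs)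
uniqLen xs uq lt with pigeonhole lt (lookup xs)
... | i , j , i<j , e = uqLookup uq i<j e

apPrefix : ∀ {A : Set} {R : A → A → Set} (xs : List A) {ys} → AllPairs R (xs ++ ys) → AllPairs R xs
apPrefix [] _ = []
apPrefix (x ∷ xs) (px ∷ rest) = AllP.++⁻ˡ xs px ∷ apPrefix xs rest

lkPrefix : ∀ {A : Set} {R : A → A → Set} (xs : List A) {ys} → Linked R (xs ++ ys) → Linked R xs
lkPrefix [] _ = []
lkPrefix (x ∷ []) _ = [-]
lkPrefix (x ∷ x' ∷ xs) (r ∷ rest) = r ∷ lkPrefix (x' ∷ xs) rest

lkSnoc : ∀ {A : Set} {R : A → A → Set} (as : List A) a b → Linked R (as ++ [ a ]) → R a b → Linked R ((as ++ [ a ]) ++ [ b ])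
lkSnoc [] a b _ r = r ∷ [-]
lkSnoc (x ∷ []) a b (r1 ∷ [-]) r = r1 ∷ r ∷ [-]
lkSnoc (x ∷ x' ∷ as) a b (r1 ∷ rest) r = r1 ∷ lkSnoc (x' ∷ as) a b rest r

lenSnoc : ∀ {A : Set} (xs : List A) a → 1 ≤ length (xs ++ [ a ])
lenSnoc [] a = s≤s z≤n
lenSnoc (x ∷ xs) a = s≤s z≤n

-- in an acyclic graph, a neighbour y of the start c of a path c p … that
-- is different from p lies off the path (otherwise a cycle would close)
module Paths {n} (T : Graph n) (ac : Acyclic T) where

  notIn : ∀ c y (pre rest : List (Fin n)) → Unique (c ∷ pre ++ rest) → Linked (Adj T) (c ∷ pre ++ rest) →
          1 ≤ length pre → Adj T y c → All (λ r → y ≢ r) rest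
  notIn c y pre [] uq lk len a = []
  notIn c y pre (r ∷ rest) uq lk len a = ne ∷ notIn c y (pre ++ [ r ]) rest uq' lk' (lenSnoc pre r) a
    where
    uq' : Unique (c ∷ (pre ++ [ r ]) ++ rest)
    uq' = subst Unique (cong (c ∷_) (sym (++-assoc pre [ r ] rest))) uq
    lk' : Linked (Adj T) (c ∷ (pre ++ [ r ]) ++ rest)
    lk' = subst (Linked (Adj T)) (cong (c ∷_) (sym (++-assoc pre [ r ] rest))) lk
    ne : y ≢ r
    ne refl = ac c (pre ++ [ y ])
      ( lenAux pre len
      , apPrefix (c ∷ pre ++ [ y ]) {rest} uq'
      , lkSnoc (c ∷ pre) y c (lkPrefix (c ∷ pre ++ [ y ]) {rest} lk') a )
      where
      lenAux : ∀ (ps : List (Fin n)) → 1 ≤ length ps → 2 ≤ length (ps ++ [ y ])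
      lenAux (_ ∷ []) _ = s≤s (s≤s z≤n)
      lenAux (_ ∷ _ ∷ ps) _ = s≤s (s≤s z≤n)

K2-case : ∀ {n} (T : Graph n) → IsTree T → ∀ c y → OnlyNeighbour T c y → OnlyNeighbour T y c → Obtainable T
K2-case {n} T (_ , conn , _) c y (acy , qc) (ayc , qy) = 2 , K2 , base , (mk↔ₛ′ to from tf ft , ad)
  where
  c≢y = adjIrr T acy
  mem : ∀ {a w} → (a ≡ c ⊎ a ≡ y) → Reach T a w → w ≡ c ⊎ w ≡ y
  mem m here = m
  mem (inj₁ refl) (step {w = b} x r) = mem (inj₂ (qc b x)) r
  mem (inj₂ refl) (step {w = b} x r) = mem (inj₁ (qy b x)) r
  to : Fin 2 → Fin n
  to zero = c
  to (suc zero) = y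
  from : Fin n → Fin 2
  from w with w ≟ c
  ... | yes _ = zero
  ... | no _ = suc zero
  tf : ∀ w → to (from w) ≡ w
  tf w with w ≟ c
  ... | yes e = sym e
  ... | no q with mem (inj₁ refl) (conn c w)
  ... | inj₁ e = ⊥-elim (q e)
  ... | inj₂ e = sym e
  ft : ∀ i → from (to i) ≡ i
  ft zero with c ≟ c
  ... | yes _ = refl
  ... | no q = ⊥-elim (q refl)
  ft (suc zero) with y ≟ c
  ... | yes e = ⊥-elim (c≢y (sym e))
  ... | no _ = refl
  ad : ∀ i j → adj T (to i) (to j) ≡ adj K2 i j
  ad zero zero = Graph.irrefl T c
  ad zero (suc zero) = acy
  ad (suc zero) zero = ayc
  ad (suc zero) (suc zero) = Graph.irrefl T y

collectFin : ∀ {m} {X : Set} (Q : Fin m → Set) → (∀ y → X ⊎ Q y) → X ⊎ (∀ y → Q y)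
collectFin {zero} Q f = inj₂ λ ()
collectFin {suc m} Q f with f zero
... | inj₁ x = inj₁ x
... | inj₂ q0 with collectFin (Q ∘ suc) (f ∘ suc)
... | inj₁ x = inj₁ x
... | inj₂ qs = inj₂ λ { zero → q0 ; (suc y) → qs y }


search : ∀ {n} (C : Fin n → Set) → (∀ y → Dec (C y)) → (∀ y (h h' : C y) → h ≡ h') → {F : Fin n → Set} →
         (ch : ∀ y → C y → F y) → (f : ∀ {y} → F y → Bool) →
         (Σ (Fin n) λ y → Σ (C y) λ h → f (ch y h) ≡ true) ⊎ (∀ y (h : C y) → f (ch y h) ≡ false)
search {n} C C? irr {F} ch f = collectFin (λ y → ∀ (h : C y) → f (ch y h) ≡ false) g
  where
  g : ∀ y → (Σ (Fin n) λ y → Σ (C y) λ h → f (ch y h) ≡ true) ⊎ (∀ (h : C y) → f (ch y h) ≡ false)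
  g y with C? y
  ... | no ¬c = inj₂ λ h → ⊥-elim (¬c h)
  ... | yes h with f (ch y h) in e
  ... | true = inj₁ (y , h , e)
  ... | false = inj₂ λ h' → trans (cong (λ k → f (ch y k)) (irr y h' h)) e

-- For an edge c p of T (p the parent), the
-- branch at c is the component of T - cp containing c.  Exploring T
-- bottom-up, every branch either contains a reducible configuration (so T
-- is obtainable) or has one of the shapes described by 'Branch p c'.

module Classify {n} (T : Graph n) (tr : IsTree T) (D P : Fin n → Bool) (eD : IsEOD T D) (eP : IsECD T P) (IH : Smaller⇒Obtainable n) where
  open Red T tr D P eD eP IH using (reduceO1; reduceO2; reduceO3; reduceO4; reduceO5; domOf)

  record QLabels (c s ℓ : Fin n) : Set where
    constructor qlabels
    field
      dc : D c ≡ true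
      pc : P c ≡ false
      ds : D s ≡ true
      ps : P s ≡ false
      pℓ : P ℓ ≡ true
      dℓ : D ℓ ≡ false

  -- possible labels of an S-branch c ℓ that is not reducible by O₁
  data SLabels (c ℓ : Fin n) : Set where
    kb : P c ≡ true → D ℓ ≡ true → SLabels c ℓ
    kc1 : P ℓ ≡ true → D ℓ ≡ true → P c ≡ false → SLabels c ℓ
    kc2 : P ℓ ≡ true → D ℓ ≡ false → P c ≡ false → SLabels c ℓ

  -- the irreducible shapes of the branch at c below p:
  --   L: c is a leaf;  S: c has one child, a leaf ℓ;
  --   Q: c s ℓ is a pendant path labelled as in QLabels;
  --   R: c ∈ P − D followed by a Q-labelled pendant path q s ℓ
  data Branch (p c : Fin n) : Set where
    tL : OnlyNeighbour T c p → Branch p c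
    tS : ∀ ℓ → TwoNeighbours T c p ℓ → OnlyNeighbour T ℓ c → SLabels c ℓ → Branch p c
    tQ : ∀ s ℓ → TwoNeighbours T c p s → TwoNeighbours T s c ℓ → OnlyNeighbour T ℓ s → QLabels c s ℓ → Branch p c
    tR : ∀ q s ℓ → TwoNeighbours T c p q → TwoNeighbours T q c s → TwoNeighbours T s q ℓ → OnlyNeighbour T ℓ s → P c ≡ true → D c ≡ false → QLabels q s ℓ → Branch p c

  isL isS isQ isR : ∀ {p c} → Branch p c → Bool
  isL (tL _) = true
  isL _ = false
  isS (tS _ _ _ _) = true
  isS _ = false
  isQ (tQ _ _ _ _ _ _) = true
  isQ _ = false
  isR (tR _ _ _ _ _ _ _ _ _ _) = true
  isR _ = false

  getL : ∀ {c z} (t : Branch c z) → isL t ≡ true → OnlyNeighbour T z c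
  getL (tL o) _ = o

  -- y is a child of c, i.e. a neighbour other than the parent p
  -- (decidable and proof-irrelevant, so children can be searched)
  Child : Fin n → Fin n → Fin n → Set
  Child c p y = adj T c y ≡ true × ⌊ y ≟ p ⌋ ≡ false

  Child? : ∀ c p y → Dec (Child c p y)
  Child? c p y with adj T c y Bool.≟ true | ⌊ y ≟ p ⌋ Bool.≟ false
  ... | yes a | yes b = yes (a , b)
  ... | no a | _ = no λ h → a (proj₁ h)
  ... | _ | no b = no λ h → b (proj₂ h)

  Child-irrelevant : ∀ c p y (h h' : Child c p y) → h ≡ h'
  Child-irrelevant c p y (a , b) (a' , b') = cong₂ _,_ (boolIrr a a') (boolIrr b b')

  child≢parent : ∀ {c p y} → Child c p y → y ≢ p
  child≢parent (_ , b) e = t≢f (trans (sym (trans (cong (λ t → ⌊ t ≟ _ ⌋) e) (≟-refl _))) b)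

  mkChild : ∀ {c p y} → Adj T c y → y ≢ p → Child c p y
  mkChild a q = a , ≟-false q

  leafCov : ∀ z c → OnlyNeighbour T z c → P c ≡ false → P z ≡ true
  leafCov z c (_ , q) pc with eP z
  ... | v , (pv , inj₁ refl) , _ = pv
  ... | v , (pv , inj₂ a) , _ = ⊥-elim (clash (subst (λ t → P t ≡ true) (q v (adjSym T a)) pv) pc)

  dU : ∀ {a b w} → D a ≡ true → Adj T a w → D b ≡ true → Adj T b w → a ≡ b
  dU da aw db bw = domUniq T D eD (da , aw) (db , bw)

  pU : ∀ {a b w} → P a ≡ true → (a ≡ w ⊎ Adj T a w) → P b ≡ true → (b ≡ w ⊎ Adj T b w) → a ≡ b
  pU pa ra pb rb = covUniq T P eP (pa , ra) (pb , rb)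

  twoFromCh : ∀ c p y → Adj T c p → Adj T c y → y ≢ p → (∀ z → Child c p z → z ≡ y) → TwoNeighbours T c p y
  twoFromCh c p y acp acy y≢p h = (λ e → y≢p (sym e)) , acp , acy , q
    where
    q : ∀ z → Adj T c z → z ≡ p ⊎ z ≡ y
    q z a with z ≟ p
    ... | yes e = inj₁ e
    ... | no z≢p = inj₂ (h z (mkChild a z≢p))

  qCoverParent : ∀ {p c s ℓ} → TwoNeighbours T c p s → QLabels c s ℓ → P p ≡ true
  qCoverParent {p} {c} {s} (_ , _ , _ , q) ql with eP c
  ... | v , (pv , inj₁ refl) , _ = ⊥-elim (clash pv (QLabels.pc ql))
  ... | v , (pv , inj₂ a) , _ with q v (adjSym T a)
  ... | inj₁ refl = pv
  ... | inj₂ refl = ⊥-elim (clash pv (QLabels.ps ql))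

  -- If c has an R-child y, then T is reducible: by O₃ if the dominator of c
  -- is p (then y is the only child), and otherwise by O₅ through the
  -- S-child dominating c.
  module RCase (c p y q s ℓ : Fin n) (acp : Adj T c p) (hy : Child c p y)
               (ty : TwoNeighbours T y c q) (tq : TwoNeighbours T q y s) (ts : TwoNeighbours T s q ℓ) (oℓ : OnlyNeighbour T ℓ s)
               (py : P y ≡ true) (dyf : D y ≡ false) (ql : QLabels q s ℓ)
               (ch : ∀ z → Child c p z → Branch c z) where
    ayc = proj₁ (proj₂ ty)
    aqy = proj₁ (proj₂ tq)
    dc : D c ≡ false
    dc = ¬true⇒false λ d → proj₁ ty (dU d (adjSym T ayc) (QLabels.dc ql) aqy)
    pc : P c ≡ false
    pc = ecdNeighbourOut T P eP py ayc
    pp : P p ≡ false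
    pp = ¬true⇒false λ pp' → child≢parent hy (sym (pU pp' (inj₂ (adjSym T acp)) py (inj₂ ayc)))

    onlyR : ∀ z → Child c p z → D p ≡ true → (t : Branch c z) → z ≡ y
    onlyR z h dp (tL o) = ⊥-elim (clash (domOf z c o) dc)
    onlyR z h dp (tS ℓz tz oz _) = ⊥-elim (child≢parent h (dU (domOf ℓz z oz) (proj₁ (proj₂ tz)) dp (adjSym T acp)))
    onlyR z h dp (tQ _ _ tz _ _ qz) = ⊥-elim (child≢parent h (dU (QLabels.dc qz) (proj₁ (proj₂ tz)) dp (adjSym T acp)))
    onlyR z h dp (tR _ _ _ tz _ _ _ pz _ _) = pU pz (inj₂ (proj₁ (proj₂ tz))) py (inj₂ ayc)

    viaChild : ∀ v0 → Child c p v0 → D v0 ≡ true → (t : Branch c v0) → Obtainable T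
    viaChild v0 h dv (tL o) = ⊥-elim (clash (domOf v0 c o) dc)
    viaChild v0 h dv (tS ℓ' tv oℓ' (kb pv dℓ')) =
      ⊥-elim (clash dv (subst (λ t → D t ≡ false) (sym (pU pv (inj₂ (proj₁ (proj₂ tv))) py (inj₂ ayc))) dyf))
    viaChild v0 h dv (tS ℓ' tv oℓ' (kc1 pℓ' dℓ' _)) =
      reduceO5 ℓ s q y c v0 ℓ' oℓ ts tq ty tv oℓ' (QLabels.pℓ ql) (QLabels.dℓ ql) (QLabels.ds ql) (QLabels.dc ql) py dyf dc pc dv dℓ' pℓ'
    viaChild v0 h dv (tS ℓ' tv oℓ' (kc2 pℓ' dℓ' _)) with eD v0
    ... | v1 , (d1 , a1) , _ with proj₂ (proj₂ (proj₂ tv)) v1 (adjSym T a1)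
    ... | inj₁ refl = ⊥-elim (clash d1 dc)
    ... | inj₂ refl = ⊥-elim (clash d1 dℓ')
    viaChild v0 h dv (tQ s' ℓ' tv _ _ qv) = ⊥-elim (clash (qCoverParent tv qv) pc)
    viaChild v0 h dv (tR _ _ _ _ _ _ _ _ dvf _) = ⊥-elim (clash dv dvf)

    result : Obtainable T
    result with eD c
    ... | v0 , (dv , av) , _ with v0 ≟ p
    ... | yes refl = reduceO3 p c y q s ℓ (twoFromCh c p y acp (adjSym T ayc) (child≢parent hy) (λ z h → onlyR z h dv (ch z h)))
                       ty tq ts oℓ dv pp dc pc
    ... | no v0≢p = viaChild v0 h dv (ch v0 h)
      where h = mkChild (adjSym T av) v0≢p

  -- If c has a Q-child y but no R-child, then y is its only child and the
  -- branch at c is R.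
  module QCase (c p y s ℓ : Fin n) (acp : Adj T c p) (hy : Child c p y)
               (ty : TwoNeighbours T y c s) (ts : TwoNeighbours T s y ℓ) (oℓ : OnlyNeighbour T ℓ s) (ql : QLabels y s ℓ)
               (ch : ∀ z → Child c p z → Branch c z) (noR : ∀ z (h : Child c p z) → isR (ch z h) ≡ false) where
    ayc = proj₁ (proj₂ ty)
    asy = proj₁ (proj₂ ts)
    pc : P c ≡ true
    pc = qCoverParent ty ql
    dc : D c ≡ false
    dc = ¬true⇒false λ d → proj₁ ty (dU d (adjSym T ayc) (QLabels.ds ql) asy)

    onlyQ : ∀ z → Child c p z → (t : Branch c z) → isR t ≡ false → z ≡ y
    onlyQ z h (tL o) _ = ⊥-elim (clash (domOf z c o) (dc))
    onlyQ z h (tS ℓz tz oz (kb pz _)) _ = ⊥-elim (adjIrr T (proj₁ (proj₂ tz)) (sym (pU pc (inj₁ refl) pz (inj₂ (proj₁ (proj₂ tz))))))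
    onlyQ z h (tS ℓz tz oz (kc1 pℓz _ _)) _ =
      ⊥-elim (child≢parent h (sym (proj₂ oz p (subst (λ t → Adj T t p) (pU pc (inj₂ (adjSym T (proj₁ (proj₂ tz)))) pℓz (inj₂ (proj₁ oz))) acp))))
    onlyQ z h (tS ℓz tz oz (kc2 pℓz _ _)) _ =
      ⊥-elim (child≢parent h (sym (proj₂ oz p (subst (λ t → Adj T t p) (pU pc (inj₂ (adjSym T (proj₁ (proj₂ tz)))) pℓz (inj₂ (proj₁ oz))) acp))))
    onlyQ z h (tQ _ _ tz _ _ qz) _ = dU (QLabels.dc qz) (proj₁ (proj₂ tz)) (QLabels.dc ql) ayc
    onlyQ z h (tR _ _ _ _ _ _ _ _ _ _) ()

    result : Branch p c
    result = tR y s ℓ (twoFromCh c p y acp (adjSym T ayc) (child≢parent hy) (λ z h → onlyQ z h (ch z h) (noR z h))) ty ts oℓ pc dc ql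

  -- If c has an S-child y but no R- or Q-child, then T is reducible by O₂
  -- or O₄, or y is the only child and the branch at c is Q.
  module SCase (c p y ℓ : Fin n) (acp : Adj T c p) (hy : Child c p y)
               (ty : TwoNeighbours T y c ℓ) (oℓ : OnlyNeighbour T ℓ y) (k : SLabels y ℓ)
               (ch : ∀ z → Child c p z → Branch c z) (noR : ∀ z (h : Child c p z) → isR (ch z h) ≡ false)
               (noQ : ∀ z (h : Child c p z) → isQ (ch z h) ≡ false) where
    ayc = proj₁ (proj₂ ty)
    aℓy = proj₁ oℓ
    dy : D y ≡ true
    dy = domOf ℓ y oℓ
    c≢ℓ = proj₁ ty

    onlyS : ∀ z → Child c p z → (t : Branch c z) → isR t ≡ false → isQ t ≡ false → (D c ≡ false ⊎ isL t ≡ false) → z ≡ y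
    onlyS z h (tL o) _ _ (inj₁ dcf) = ⊥-elim (clash (domOf z c o) dcf)
    onlyS z h (tL o) _ _ (inj₂ ())
    onlyS z h (tS ℓz tz oz _) _ _ _ = dU (domOf ℓz z oz) (proj₁ (proj₂ tz)) dy ayc
    onlyS z h (tQ _ _ _ _ _ _) _ () _
    onlyS z h (tR _ _ _ _ _ _ _ _ _ _) () _ _

    twoC : (∀ z (h : Child c p z) → D c ≡ false ⊎ isL (ch z h) ≡ false) → TwoNeighbours T c p y
    twoC alt = twoFromCh c p y acp (adjSym T ayc) (child≢parent hy) (λ z h → onlyS z h (ch z h) (noR z h) (noQ z h) (alt z h))

    -- with ℓ ∈ D, neither c nor p is in D: reduce by O₂
    routeA : D ℓ ≡ true → P c ≡ false → Obtainable T
    routeA dℓ pcF = reduceO2 p c y ℓ (twoC (λ _ _ → inj₁ dcF)) ty oℓ dpF dcF pcF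
      where
      dcF : D c ≡ false
      dcF = ¬true⇒false λ d → c≢ℓ (dU d (adjSym T ayc) dℓ aℓy)
      dpF : D p ≡ false
      dpF = ¬true⇒false λ d → child≢parent hy (sym (dU d (adjSym T acp) dy ayc))

    -- ℓ ∈ P covers y, so its neighbour c is not in P
    cNotP : P ℓ ≡ true → P c ≡ false
    cNotP pℓ = ¬true⇒false λ pc' → c≢ℓ (pU pc' (inj₂ (adjSym T ayc)) pℓ (inj₂ aℓy))

    -- y is dominated by c or ℓ, hence by c when ℓ ∉ D
    cInD : D ℓ ≡ false → D c ≡ true
    cInD dℓ with eD y
    ... | v1 , (d1 , a1) , _ with proj₂ (proj₂ (proj₂ ty)) v1 (adjSym T a1)
    ... | inj₁ refl = d1
    ... | inj₂ refl = ⊥-elim (clash d1 dℓ)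

    -- with ℓ ∈ P − D, a leaf child of c gives O₄; otherwise the branch is Q
    routeB : P ℓ ≡ true → D ℓ ≡ false → P y ≡ false → Obtainable T ⊎ Branch p c
    routeB pℓ dℓ pyF with search (Child c p) (Child? c p) (Child-irrelevant c p) ch isL
    ... | inj₁ (z , h , e) =
      inj₁ (reduceO4 z c y ℓ o (twoSwap T ty) oℓ dy (cInD dℓ) pℓ (leafCov z c o (cNotP pℓ)))
      where o = getL (ch z h) e
    ... | inj₂ noL = inj₂ (tQ y ℓ (twoC (λ z h → inj₂ (noL z h))) ty oℓ (qlabels (cInD dℓ) (cNotP pℓ) dy pyF pℓ dℓ))

    result' : SLabels y ℓ → Obtainable T ⊎ Branch p c
    result' (kb py dℓ) = inj₁ (routeA dℓ (ecdNeighbourOut T P eP py ayc))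
    result' (kc1 pℓ dℓ pyF) = inj₁ (routeA dℓ (cNotP pℓ))
    result' (kc2 pℓ dℓ pyF) = routeB pℓ dℓ pyF

    result : Obtainable T ⊎ Branch p c
    result = result' k

  allFalse : ∀ {c z} (t : Branch c z) → isL t ≡ false → isS t ≡ false → isQ t ≡ false → isR t ≡ false → ⊥
  allFalse (tL _) () _ _ _
  allFalse (tS _ _ _ _) _ () _ _
  allFalse (tQ _ _ _ _ _ _) _ _ () _
  allFalse (tR _ _ _ _ _ _ _ _ _ _) _ _ _ ()

  -- If all children of c are leaves, then T is reducible by O₁, or c has at
  -- most one child and the branch at c is L or S.
  module LCase (c p : Fin n) (acp : Adj T c p) (ch : ∀ z → Child c p z → Branch c z)
               (noR : ∀ z (h : Child c p z) → isR (ch z h) ≡ false)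
               (noQ : ∀ z (h : Child c p z) → isQ (ch z h) ≡ false)
               (noS : ∀ z (h : Child c p z) → isS (ch z h) ≡ false) where
    C2 : Fin n → Fin n → Set
    C2 y z = Child c p z × ⌊ z ≟ y ⌋ ≡ false

    C2? : ∀ y z → Dec (C2 y z)
    C2? y z with Child? c p z | ⌊ z ≟ y ⌋ Bool.≟ false
    ... | yes a | yes b = yes (a , b)
    ... | no a | _ = no λ h → a (proj₁ h)
    ... | _ | no b = no λ h → b (proj₂ h)

    C2Irr : ∀ y z (h h' : C2 y z) → h ≡ h'
    C2Irr y z (a , b) (a' , b') = cong₂ _,_ (Child-irrelevant c p z a a') (boolIrr b b')

    classify : ∀ y → OnlyNeighbour T y c → TwoNeighbours T c p y → Obtainable T ⊎ Branch p c
    classify y o two with P c in pc | D y in dy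
    ... | true | false = inj₁ (reduceO1 y c o dy pc)
    ... | true | true = inj₂ (tS y two o (kb pc dy))
    ... | false | true = inj₂ (tS y two o (kc1 (leafCov y c o pc) dy pc))
    ... | false | false = inj₂ (tS y two o (kc2 (leafCov y c o pc) dy pc))

    -- two leaf children: both would need to be in P unless c ∈ P, so c ∈ P
    -- and one of them is not in D, giving O₁
    twoLeaves : ∀ y z → OnlyNeighbour T y c → OnlyNeighbour T z c → z ≢ y → Obtainable T
    twoLeaves y z oy oz z≢y with P c in pc
    ... | false = ⊥-elim (z≢y (pU (leafCov z c oz pc) (inj₂ (proj₁ oz)) (leafCov y c oy pc) (inj₂ (proj₁ oy))))
    ... | true with D y in dy
    ... | false = reduceO1 y c oy dy pc
    ... | true = reduceO1 z c oz (¬true⇒false λ dz → z≢y (dU dz (proj₁ oz) dy (proj₁ oy))) pc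

    result : Obtainable T ⊎ Branch p c
    result with search (Child c p) (Child? c p) (Child-irrelevant c p) ch isL
    ... | inj₂ noL = inj₂ (tL (acp , q))
      where
      q : ∀ z → Adj T c z → z ≡ p
      q z a with z ≟ p
      ... | yes e = e
      ... | no z≢p = ⊥-elim (allFalse (ch z h) (noL z h) (noS z h) (noQ z h) (noR z h)) where h = mkChild a z≢p
    ... | inj₁ (y , hy , e) with search (C2 y) (C2? y) (C2Irr y) (λ z h → ch z (proj₁ h)) isL
    ... | inj₁ (z , hz , e') = inj₁ (twoLeaves y z (getL (ch y hy) e) (getL (ch z (proj₁ hz)) e')
                                     λ q → t≢f (trans (sym (trans (cong (λ t → ⌊ t ≟ y ⌋) q) (≟-refl y))) (proj₂ hz)))
    ... | inj₂ noL2 = classify y oy (twoFromCh c p y acp (adjSym T (proj₁ oy)) (child≢parent hy) onlyL)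
      where
      oy = getL (ch y hy) e
      onlyL : ∀ z → Child c p z → z ≡ y
      onlyL z h with z ≟ y
      ... | yes q = q
      ... | no q = ⊥-elim (allFalse (ch z h) (noL2 z (h , ≟-false q)) (noS z h) (noQ z h) (noR z h))

  -- Given the branches of all children of c, the branch at c is reducible
  -- or of one of the four shapes; children are examined in the order R, Q,
  -- S, L ('combine').
  caseR : ∀ c p y (acp : Adj T c p) (h : Child c p y) (ch : ∀ z → Child c p z → Branch c z) (t : Branch c y) → isR t ≡ true → Obtainable T
  caseR c p y acp h ch (tR q s ℓ ty tq ts oℓ py dyf ql) _ = RCase.result c p y q s ℓ acp h ty tq ts oℓ py dyf ql ch

  caseQ : ∀ c p y (acp : Adj T c p) (h : Child c p y) (ch : ∀ z → Child c p z → Branch c z) →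
          (∀ z (h : Child c p z) → isR (ch z h) ≡ false) → (t : Branch c y) → isQ t ≡ true → Branch p c
  caseQ c p y acp h ch noR (tQ s ℓ ty ts oℓ ql) _ = QCase.result c p y s ℓ acp h ty ts oℓ ql ch noR

  caseS : ∀ c p y (acp : Adj T c p) (h : Child c p y) (ch : ∀ z → Child c p z → Branch c z) →
          (∀ z (h : Child c p z) → isR (ch z h) ≡ false) → (∀ z (h : Child c p z) → isQ (ch z h) ≡ false) →
          (t : Branch c y) → isS t ≡ true → Obtainable T ⊎ Branch p c
  caseS c p y acp h ch noR noQ (tS ℓ ty oℓ k) _ = SCase.result c p y ℓ acp h ty oℓ k ch noR noQ

  combine : ∀ c p → Adj T c p → (∀ z → Child c p z → Branch c z) → Obtainable T ⊎ Branch p c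
  combine c p acp ch with search (Child c p) (Child? c p) (Child-irrelevant c p) ch isR
  ... | inj₁ (y , h , e) = inj₁ (caseR c p y acp h ch (ch y h) e)
  ... | inj₂ noR with search (Child c p) (Child? c p) (Child-irrelevant c p) ch isQ
  ... | inj₁ (y , h , e) = inj₂ (caseQ c p y acp h ch noR (ch y h) e)
  ... | inj₂ noQ with search (Child c p) (Child? c p) (Child-irrelevant c p) ch isS
  ... | inj₁ (y , h , e) = caseS c p y acp h ch noR noQ (ch y h) e
  ... | inj₂ noS = LCase.result c p acp ch noR noQ noS

-- Walk from any vertex to a leaf r; explore T from r, computing for
-- each edge c p the branch at c from the branches of the children of c.
-- The search is bounded by the length of the explored path, which is
-- duplicate-free and hence has at most n vertices.

module Completeness {n} (T : Graph n) (tr : IsTree T) (D P : Fin n → Bool) (eD : IsEOD T D) (eP : IsECD T P) (IH : Smaller⇒Obtainable n) where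
  open Classify T tr D P eD eP IH
  open Red T tr D P eD eP IH using (reduceO1; reduceO4; domOf)
  open Paths T (proj₂ (proj₂ tr))

  extendPath : ∀ {c p y : Fin n} {path} → Unique (c ∷ p ∷ path) → Linked (Adj T) (c ∷ p ∷ path) → Adj T c y → y ≢ p →
         Unique (y ∷ c ∷ p ∷ path) × Linked (Adj T) (y ∷ c ∷ p ∷ path)
  extendPath {c} {p} {y} {path} uq lk a y≢p =
    ((λ e → adjIrr T a (sym e)) ∷ y≢p ∷ notIn c y (p ∷ []) path uq lk (s≤s z≤n) (adjSym T a)) ∷ uq ,
    adjSym T a ∷ lk

  fuelShift : ∀ k (L : ℕ) → n < suc k + L → n < k + suc L
  fuelShift k L b = subst (n <_) (sym (+-suc k L)) b

  findLeaf : ∀ k c p → Adj T c p → ∀ path → Unique (c ∷ p ∷ path) → Linked (Adj T) (c ∷ p ∷ path) →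
             n < k + length (c ∷ p ∷ path) → Σ (Fin n) λ ℓ → Σ (Fin n) λ u → OnlyNeighbour T ℓ u
  findLeaf zero c p a path uq lk b = ⊥-elim (uniqLen _ uq b)
  findLeaf (suc k) c p a path uq lk b with any? (λ y → (adj T c y Bool.≟ true) ×-dec ¬? (y ≟ p))
  ... | yes (y , ay , y≢p) =
        findLeaf k y c (adjSym T ay) (p ∷ path) (proj₁ (extendPath uq lk ay y≢p)) (proj₂ (extendPath uq lk ay y≢p))
          (fuelShift k (length (c ∷ p ∷ path)) b)
  ... | no ¬ex = c , p , a , q
    where
    q : ∀ y → Adj T c y → y ≡ p
    q y ay with y ≟ p
    ... | yes e = e
    ... | no ne = ⊥-elim (¬ex (y , ay , ne))

  explore : ∀ k c p → Adj T c p → ∀ path → Unique (c ∷ p ∷ path) → Linked (Adj T) (c ∷ p ∷ path) →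
            n < k + length (c ∷ p ∷ path) → Obtainable T ⊎ Branch p c
  exploreCh : ∀ k c p → Adj T c p → ∀ path → Unique (c ∷ p ∷ path) → Linked (Adj T) (c ∷ p ∷ path) →
              n < suc k + length (c ∷ p ∷ path) → ∀ y → Obtainable T ⊎ (Child c p y → Branch c y)
  explore zero c p a path uq lk b = ⊥-elim (uniqLen _ uq b)
  explore (suc k) c p a path uq lk b with collectFin (λ y → Child c p y → Branch c y) (exploreCh k c p a path uq lk b)
  ... | inj₁ ob = inj₁ ob
  ... | inj₂ ch = combine c p a ch
  exploreCh k c p a path uq lk b y with Child? c p y
  ... | no ¬h = inj₂ λ h → ⊥-elim (¬h h)
  ... | yes h with explore k y c (adjSym T (proj₁ h)) (p ∷ path) (proj₁ (extendPath uq lk (proj₁ h) (child≢parent h)))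
                   (proj₂ (extendPath uq lk (proj₁ h) (child≢parent h))) (fuelShift k (length (c ∷ p ∷ path)) b)
  ... | inj₁ ob = inj₁ ob
  ... | inj₂ t = inj₂ λ _ → t

  -- the branch at the neighbour c of the leaf r is all of T but r: it is
  -- K₂ (L), reducible by O₁ (S) or by O₄ (Q); S with c ∉ P and R violate
  -- the labels at r
  -- two leaves r, ℓ at c ∉ P would both have to be in P, covering c twice
  twoCentreless : ∀ r c ℓ → OnlyNeighbour T r c → TwoNeighbours T c r ℓ → OnlyNeighbour T ℓ c →
                  P ℓ ≡ true → P c ≡ false → ⊥
  twoCentreless r c ℓ or two oℓ pℓ pcF = proj₁ two (pU (leafCov r c or pcF) (inj₂ (proj₁ or)) pℓ (inj₂ (proj₁ oℓ)))

  topCase : ∀ r c → OnlyNeighbour T r c → Branch r c → Obtainable T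
  topCase r c or (tL oc) = K2-case T tr r c or oc
  topCase r c or (tS ℓ two oℓ (kb pc dℓ)) =
    reduceO1 r c or (¬true⇒false λ dr → proj₁ two (dU dr (proj₁ or) dℓ (proj₁ oℓ))) pc
  topCase r c or (tS ℓ two oℓ (kc1 pℓ _ pcF)) = ⊥-elim (twoCentreless r c ℓ or two oℓ pℓ pcF)
  topCase r c or (tS ℓ two oℓ (kc2 pℓ _ pcF)) = ⊥-elim (twoCentreless r c ℓ or two oℓ pℓ pcF)
  topCase r c or (tQ s ℓ two ts oℓ ql) =
    reduceO4 r c s ℓ or (twoSwap T ts) oℓ (QLabels.ds ql) (QLabels.dc ql) (QLabels.pℓ ql) (leafCov r c or (QLabels.pc ql))
  topCase r c or (tR _ _ _ _ _ _ _ _ dcF _) = ⊥-elim (clash (domOf r c or) dcF)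

  obtainable : Obtainable T
  obtainable with eD (pos⇒fin (proj₁ tr))
  ... | b , (_ , ab) , _ with findLeaf n b a ab [] (((adjIrr T ab) ∷ []) ∷ [] ∷ []) (ab ∷ [-]) (m<m+n n (s≤s z≤n))
    where a = pos⇒fin (proj₁ tr)
  ... | r , c , or with explore n c r (adjSym T (proj₁ or)) [] (((λ e → adjIrr T (proj₁ or) (sym e)) ∷ []) ∷ [] ∷ [])
                         (adjSym T (proj₁ or) ∷ [-]) (m<m+n n (s≤s z≤n))
  ... | inj₁ ob = ob
  ... | inj₂ t = topCase r c or t

EOCD⇒obtainable : ∀ n (T : Graph n) → IsTree T → IsEOCD T → Obtainable T
EOCD⇒obtainable = <-rec (λ n → (T : Graph n) → IsTree T → IsEOCD T → Obtainable T) inductionStep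
  where
  inductionStep : ∀ n → Smaller⇒Obtainable n → (T : Graph n) → IsTree T → IsEOCD T → Obtainable T
  inductionStep n rec T tr ((D , eD) , (P , eP)) = Completeness.obtainable T tr D P eD eP rec

theorem4p1 : ∀ {n : ℕ} (T : Graph n) → IsTree T → (IsEOCD T ⇔ Obtainable T)
theorem4p1 {n} T tr = mk⇔ (EOCD⇒obtainable n T tr) (obtainable⇒EOCD T)
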